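{- For $0<\alpha\in\mathcal O_K$, its (finite) greedy expansion is the only element $x$ of $\mathcal O_\theta^+$ satisfying $\pi(x)=\pi(\alpha)$. In other words, $\pi^{ -1}(\pi(\alpha))$ has a unique element in $\mathcal O_\theta^+$.
   Context: $\theta>1$ is a real quadratic unit with $N(\theta)=-1$, so $\theta^2=a\theta+1$ with an integer $a\ge1$; $K=\mathbb Q(\theta)\subset\mathbb R$, $\mathcal O_K$ its ring of integers. A greedy polynomial is a finite sum $\sum_{i=m}^M b_i\theta^i$ with $b_i\in\{0,\dots,a\}$ such that $b_i=a$ implies $b_{i-1}=0$; every nonzero $\alpha\in\mathcal O_K$ is uniquely $\pm$ such a sum with $b_m\ne0$ (its greedy expansion), and $|\alpha|_\theta:=\theta^{ -m}$, $|0|_\theta=0$. $\widehat{\mathcal O}_\theta$ is the ring of sequences in $\mathcal O_K$ that are Cauchy for $|\cdot|_\theta$ modulo those with $|f_n|_\theta\to0$; $\mathcal O_K\subset\widehat{\mathcal O}_\theta$ via constant sequences. $\mathcal O_\theta^+$ is the set of greedy Laurent series $x=\sum_{i\ge m}b_i\theta^i$ (formal series with $b_i\in\{0,\dots,a\}$ all of whose truncations are greedy polynomials). A sequence $(x_n)$ in $\mathcal O_K$ is a sequence of partial sums of $x$ if there are integers $M_n$, nondecreasing, $M_n\to\infty$, with $x_n=\sum_{i=m}^{M_n}b_i\theta^i+\delta_n$, $\delta_n$ a greedy polynomial involving only powers $\theta^j$, $j>M_n$. All such sequences are Cauchy and define the same class $\pi(x)\in\widehat{\mathcal O}_\theta$.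 The set $\mathcal O_\theta=\mathcal O_\theta^+\cup(-\mathcal O_\theta^+)$ with $\pi(-x)=-\pi(x)$; a positive $\alpha\in\mathcal O_K$ is regarded as an element of $\mathcal O_\theta^+$ via its greedy expansion. -}

module Defs where

open import Data.Nat as ℕ using (ℕ; zero; suc)
open import Data.Integer as ℤ using (ℤ; +_; -[1+_]; _+_; _-_; _*_; -_; 0ℤ; 1ℤ)
open import Data.Product using (_×_; _,_; Σ; ∃; ∃-syntax)
open import Data.Sum using (_⊎_)
open import Data.List using (List; []; _∷_)
open import Relation.Binary.PropositionalEquality using (_≡_)
open import Function.Bundles using (_⇔_)

-- Everything is parameterised by the integer a ≥ 1 with θ² = aθ + 1.
-- Elements of O_K = ℤ[θ] are written p + qθ, represented by (p , q).

ℤθ : Set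
ℤθ = ℤ × ℤ

module _ (a : ℕ) where

  private
    A : ℤ
    A = + a

  ι : ℤ → ℤθ
  ι n = n , 0ℤ

  0θ 1θ θ θ⁻¹ : ℤθ
  0θ = 0ℤ , 0ℤ
  1θ = 1ℤ , 0ℤ
  θ  = 0ℤ , 1ℤ
  -- θ (θ - a) = θ² - aθ = 1
  θ⁻¹ = - A , 1ℤ

  _⊕_ : ℤθ → ℤθ → ℤθ
  (p , q) ⊕ (r , s) = p + r , q + s

  ⊖_ : ℤθ → ℤθ
  ⊖ (p , q) = - p , - q

  _⊖_ : ℤθ → ℤθ → ℤθ
  x ⊖ y = x ⊕ (⊖ y)

  -- (p + qθ)(r + sθ) = (pr + qs) + (ps + qr + a qs) θ   using θ² = aθ + 1
  _⊗_ : ℤθ → ℤθ → ℤθ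
  (p , q) ⊗ (r , s) = p * r + q * s , p * s + q * r + A * (q * s)

  powℕ : ℤθ → ℕ → ℤθ
  powℕ x zero    = 1θ
  powℕ x (suc n) = x ⊗ powℕ x n

  θ^ : ℤ → ℤθ
  θ^ (+ n)     = powℕ θ n
  θ^ -[1+ n ]  = powℕ θ⁻¹ (suc n)

  -- Positivity of p + qθ as a real number, θ = (a + √D)/2, D = a² + 4.
  -- 2(p + qθ) = u + v√D with u = 2p + aq, v = q.
  -- u + v√D > 0  iff  one of the three (exhaustive) cases below holds.
  Positive : ℤθ → Set
  Positive (p , q) =
      (0ℤ ℤ.< u × v * v * D ℤ.< u * u)
    ⊎ (0ℤ ℤ.< v × u * u ℤ.< v * v * D)
    ⊎ (0ℤ ℤ.≤ u × 0ℤ ℤ.≤ v × 0ℤ ℤ.< u + v)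
    where
      u v D : ℤ
      u = + 2 * p + A * q
      v = q
      D = A * A + + 4

  -- Greedy polynomials: digits [b_m, b_{m+1}, …, b_M] (increasing index),
  -- each b_i ∈ {0,…,a}, and b_i = a ⇒ b_{i-1} = 0.

  data GreedyDigits : List ℕ → Set where
    []  : GreedyDigits []
    [_] : ∀ {b} → b ℕ.≤ a → GreedyDigits (b ∷ [])
    _∷_ : ∀ {b c cs} → b ℕ.≤ a → (c ≡ a → b ≡ 0) →
          GreedyDigits (c ∷ cs) → GreedyDigits (b ∷ c ∷ cs)

  evalDigits : ℤ → List ℕ → ℤθ
  evalDigits m []       = 0θ
  evalDigits m (b ∷ bs) = (ι (+ b) ⊗ θ^ m) ⊕ evalDigits (m + 1ℤ) bs

  -- β is 0 or ± a greedy polynomial involving only powers θ^j with j ≥ k;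
  -- by uniqueness of greedy expansions this says |β|_θ ≤ θ^{-k}.
  SmallBy : ℤ → ℤθ → Set
  SmallBy k β =
      β ≡ 0θ
    ⊎ Σ ℤ λ m → Σ (List ℕ) λ bs →
        k ℤ.≤ m × GreedyDigits bs × (β ≡ evalDigits m bs ⊎ β ≡ ⊖ evalDigits m bs)

  -- Greedy Laurent series x = Σ_{i ≥ low} b_i θ^i  (elements of O_θ^+),
  -- coefficients given as a function on ℤ vanishing below `low`.

  record GreedySeries : Set where
    field
      low     : ℤ
      digit   : ℤ → ℕ
      digit≤a : ∀ i → digit i ℕ.≤ a
      greedy  : ∀ i → digit (i + 1ℤ) ≡ a → digit i ≡ 0
      below   : ∀ i → i ℤ.< low → digit i ≡ 0

  open GreedySeries public

  _≈S_ : GreedySeries → GreedySeries → Set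
  x ≈S y = ∀ i → digit x i ≡ digit y i

  partialFrom : (ℤ → ℕ) → ℤ → ℕ → ℤθ
  partialFrom d m zero    = 0θ
  partialFrom d m (suc n) = (ι (+ d m) ⊗ θ^ m) ⊕ partialFrom d (m + 1ℤ) n

  partial : GreedySeries → ℕ → ℤθ
  partial x n = partialFrom (digit x) (low x) n

  -- π(x) = π(α) in the completion Ô_θ: the sequence of partial sums of x
  -- minus the constant sequence α tends to 0 for |·|_θ.
  πEq : GreedySeries → ℤθ → Set
  πEq x α = ∀ (k : ℤ) → ∃[ N ] ∀ n → N ℕ.≤ n → SmallBy k (partial x n ⊖ α)

  IsGreedyExpansionOf : GreedySeries → ℤθ → Set
  IsGreedyExpansionOf x α =
    ∃[ N ] ((∀ i → low x + + N ℤ.≤ i → digit x i ≡ 0) × partial x N ≡ α)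

-- Work in ℤ[θ], θ² = aθ + 1, and let x ≥ 0 mean that θⁿ x ∈ ℕ + ℕθ for some n. A positive
-- α is such an element: multiplying by θ eventually makes both coordinates nonnegative. Every
-- element of ℕ + ℕθ, hence (after a shift by θ⁻ⁿ) α itself, has a finite greedy expansion:
-- add 1 and θ to a greedy digit string one at a time and normalise with the carry rules
-- a + θ⁻¹ = θ and a + 1 = θ + (a - 1)θ⁻¹ + θ⁻². Greedy digits on [m, m + L) sum to less
-- than θ^(m + L); this makes finite greedy expansions unique, and it fixes the sign in
-- π(x) = π(α): once k exceeds the top of the expansion of α, a late partial sum of x is α plus
-- a greedy polynomial starting at or above k, so the digits of x below k are those of α.
-- Conversely the partial sums of the expansion of α are eventually equal to α.

module Submission where

open import Defs
open import Data.Nat using (ℕ; _≤_)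
open import Function.Bundles using (_⇔_)

open import Algebra.Bundles using (CommutativeRing)
open import Algebra.Structures using (IsCommutativeRing)
open import Algebra.Definitions
import Algebra.Solver.Ring as RingSolver
open import Algebra.Solver.Ring.AlmostCommutativeRing
  using (fromCommutativeRing; _-Raw-AlmostCommutative⟶_)
open import Data.Empty using (⊥; ⊥-elim)
open import Data.Integer as ℤ using (ℤ; +_; -[1+_]; 0ℤ; 1ℤ; _+_; _-_; _*_; -_)
import Data.Integer.Properties as ℤP
open import Data.Integer.Tactic.RingSolver using (solve-∀)
open import Data.List using (List; []; _∷_; length)
open import Data.Maybe using (Maybe; just; nothing)
import Data.Nat as ℕ
import Data.Nat.Properties as ℕP
open import Data.Product using (_×_; _,_; Σ; ∃; ∃-syntax; proj₁; proj₂; map₂)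
open import Data.Sum using (_⊎_; inj₁; inj₂)
import Data.Sum
open import Function.Base using (_∘_)
open import Function.Bundles using (mk⇔)
open import Relation.Binary.PropositionalEquality
open import Relation.Binary.Definitions using (tri<; tri≈; tri>)
open import Relation.Nullary using (yes; no)

module IntegerFacts where

  i≤j⇒j≡i+∣i-j∣ : ∀ {i j} → i ℤ.≤ j → j ≡ i + + ℤ.∣ i - j ∣
  i≤j⇒j≡i+∣i-j∣ {i} {j} i≤j = trans (sym (lemma i j)) (cong (_+_ i) (sym (ℤP.∣-∣-≤ i≤j)))
    where
    lemma : ∀ i j → i + (j - i) ≡ j
    lemma = solve-∀

  j≤i+∣i-j∣ : ∀ i j → j ℤ.≤ i + + ℤ.∣ i - j ∣
  j≤i+∣i-j∣ i j with ℤP.≤-total j i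
  ... | inj₁ j≤i = ℤP.≤-trans j≤i (ℤP.i≤i+j i (+ _))
  ... | inj₂ i≤j = ℤP.≤-reflexive (i≤j⇒j≡i+∣i-j∣ i≤j)

  i≤i+n : ∀ i n → i ℤ.≤ i + + n
  i≤i+n i n = ℤP.i≤i+j i (+ n)

  i+m<i+n : ∀ i {m n} → m ℕ.< n → i + + m ℤ.< i + + n
  i+m<i+n i m<n = ℤP.+-monoʳ-< i (ℤ.+<+ m<n)

  i<i+1 : ∀ i → i ℤ.< i + 1ℤ
  i<i+1 i = ℤP.suc[i]≤j⇒i<j (ℤP.≤-reflexive (ℤP.+-comm 1ℤ i))

  i<j+1⇒i≤j : ∀ {i j} → i ℤ.< j + 1ℤ → i ℤ.≤ j
  i<j+1⇒i≤j {i} {j} i<j+1 = ℤP.≮⇒≥ λ j<i →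
    ℤP.<-irrefl refl (ℤP.<-≤-trans i<j+1 (subst (ℤ._≤ i) (ℤP.+-comm 1ℤ j) (ℤP.i<j⇒suc[i]≤j j<i)))

  i+1+n≡i+[1+n] : ∀ i n → i + 1ℤ + + n ≡ i + + ℕ.suc n
  i+1+n≡i+[1+n] i n = ℤP.+-assoc i 1ℤ (+ n)

  i+[1+n]≡i+n+1 : ∀ i n → i + + ℕ.suc n ≡ i + + n + 1ℤ
  i+[1+n]≡i+n+1 i n = lemma i (+ n)
    where
    lemma : ∀ i n → i + (1ℤ + n) ≡ i + n + 1ℤ
    lemma = solve-∀

  i+[1+n]-1≡i+n : ∀ i n → i + + ℕ.suc n - 1ℤ ≡ i + + n
  i+[1+n]-1≡i+n i n = lemma i (+ n)
    where
    lemma : ∀ i n → i + (1ℤ + n) - 1ℤ ≡ i + n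
    lemma = solve-∀

  0≤⇒ℕ : ∀ {x} → 0ℤ ℤ.≤ x → ∃[ n ] x ≡ + n
  0≤⇒ℕ (ℤ.+≤+ {n = n} _) = n , refl

  0<⇒ℕ⁺ : ∀ {x} → 0ℤ ℤ.< x → ∃[ n ] x ≡ + ℕ.suc n
  0<⇒ℕ⁺ (ℤ.+<+ {n = ℕ.suc n} _) = n , refl

  0≤+ : ∀ n → 0ℤ ℤ.≤ + n
  0≤+ _ = ℤ.+≤+ ℕ.z≤n

  0<+suc : ∀ n → 0ℤ ℤ.< + ℕ.suc n
  0<+suc _ = ℤ.+<+ (ℕ.s≤s ℕ.z≤n)

  0≤-+ : ∀ {x y} → 0ℤ ℤ.≤ x → 0ℤ ℤ.≤ y → 0ℤ ℤ.≤ x + y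
  0≤-+ = ℤP.+-mono-≤

  0<-+ : ∀ {x y} → 0ℤ ℤ.< x → 0ℤ ℤ.≤ y → 0ℤ ℤ.< x + y
  0<-+ = ℤP.+-mono-<-≤

  0≤-* : ∀ {x y} → 0ℤ ℤ.≤ x → 0ℤ ℤ.≤ y → 0ℤ ℤ.≤ x * y
  0≤-* 0≤x 0≤y with 0≤⇒ℕ 0≤x | 0≤⇒ℕ 0≤y
  ... | m , refl | n , refl = subst (0ℤ ℤ.≤_) (ℤP.pos-* m n) (0≤+ (m ℕ.* n))

  0<-* : ∀ {x y} → 0ℤ ℤ.< x → 0ℤ ℤ.< y → 0ℤ ℤ.< x * y
  0<-* 0<x 0<y with 0<⇒ℕ⁺ 0<x | 0<⇒ℕ⁺ 0<y
  ... | m , refl | n , refl = subst (0ℤ ℤ.<_) (ℤP.pos-* (ℕ.suc m) (ℕ.suc n)) (0<+suc (n ℕ.+ m ℕ.* ℕ.suc n))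

  0≤-square : ∀ x → 0ℤ ℤ.≤ x * x
  0≤-square (+ n)    = 0≤-* (0≤+ n) (0≤+ n)
  0≤-square -[1+ n ] = 0≤+ _

  0≤-neg : ∀ {x} → x ℤ.≤ 0ℤ → 0ℤ ℤ.≤ - x
  0≤-neg = ℤP.neg-mono-≤

  0<-neg : ∀ {x} → x ℤ.< 0ℤ → 0ℤ ℤ.< - x
  0<-neg = ℤP.neg-mono-<

  0≤-half : ∀ x → 0ℤ ℤ.≤ + 2 * x → 0ℤ ℤ.≤ x
  0≤-half (+ n)    _        = 0≤+ n
  0≤-half -[1+ n ] ()

  0<-half : ∀ x → 0ℤ ℤ.< + 2 * x → 0ℤ ℤ.< x
  0<-half (+ ℕ.zero)  (ℤ.+<+ ())
  0<-half (+ ℕ.suc n) _         = 0<+suc n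
  0<-half -[1+ n ]    ()

  0<-+≢0 : ∀ {x y} → 0ℤ ℤ.< x → 0ℤ ℤ.≤ y → x + y ≢ 0ℤ
  0<-+≢0 0<x 0≤y eq = ℤP.<-irrefl (sym eq) (0<-+ 0<x 0≤y)

  <⇒0<- : ∀ {i j} → i ℤ.< j → 0ℤ ℤ.< j - i
  <⇒0<- {i} {j} i<j = subst (ℤ._< j - i) (ℤP.+-inverseʳ i) (ℤP.+-monoˡ-< (- i) i<j)

  0<-⇒< : ∀ {i j} → 0ℤ ℤ.< j - i → i ℤ.< j
  0<-⇒< {i} {j} 0<j-i = subst₂ ℤ._<_ (ℤP.+-identityˡ i) (lemma i j) (ℤP.+-monoˡ-< i 0<j-i)
    where
    lemma : ∀ i j → j - i + i ≡ j
    lemma = solve-∀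

  +-cancelˡ-< : ∀ w {x y} → w + x ℤ.< w + y → x ℤ.< y
  +-cancelˡ-< w {x} {y} w+x<w+y = 0<-⇒< (subst (0ℤ ℤ.<_) (lemma w x y) (<⇒0<- w+x<w+y))
    where
    lemma : ∀ w x y → w + y - (w + x) ≡ y - x
    lemma = solve-∀

module ZTheta (a : ℕ) where

  open IntegerFacts

  A : ℤ
  A = + a

  infixl 6 _+θ_ _-θ_
  infixl 7 _*θ_

  _+θ_ _-θ_ _*θ_ : ℤθ → ℤθ → ℤθ
  _+θ_ = _⊕_ a
  _-θ_ = _⊖_ a
  _*θ_ = _⊗_ a

  negθ : ℤθ → ℤθ
  negθ = ⊖_ a

  𝟘 𝟙 ϑ ϑ⁻¹ : ℤθ
  𝟘   = 0θ a
  𝟙   = 1θ a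
  ϑ   = θ a
  ϑ⁻¹ = θ⁻¹ a

  ⌜_⌝ : ℕ → ℤθ
  ⌜ n ⌝ = ι a (+ n)

  ϑ^ : ℤ → ℤθ
  ϑ^ = θ^ a

  ϑⁿ ϑ⁻ⁿ : ℕ → ℤθ
  ϑⁿ  = powℕ a ϑ
  ϑ⁻ⁿ = powℕ a ϑ⁻¹

  ⌜suc⌝ : ∀ n → ⌜ ℕ.suc n ⌝ ≡ 𝟙 +θ ⌜ n ⌝
  ⌜suc⌝ n = cong₂ _,_ (ℤP.pos-+ 1 n) refl

  ⌜+⌝ : ∀ m n → ⌜ m ℕ.+ n ⌝ ≡ ⌜ m ⌝ +θ ⌜ n ⌝
  ⌜+⌝ m n = cong₂ _,_ (ℤP.pos-+ m n) refl

  +θ-assoc : Associative _≡_ _+θ_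
  +θ-assoc (p , q) (r , s) (t , u) = cong₂ _,_ (ℤP.+-assoc p r t) (ℤP.+-assoc q s u)

  +θ-comm : Commutative _≡_ _+θ_
  +θ-comm (p , q) (r , s) = cong₂ _,_ (ℤP.+-comm p r) (ℤP.+-comm q s)

  +θ-identity : Identity _≡_ 𝟘 _+θ_
  +θ-identity = (λ (p , q) → cong₂ _,_ (ℤP.+-identityˡ p) (ℤP.+-identityˡ q))
              , (λ (p , q) → cong₂ _,_ (ℤP.+-identityʳ p) (ℤP.+-identityʳ q))

  negθ-inverse : Inverse _≡_ 𝟘 negθ _+θ_
  negθ-inverse = (λ (p , q) → cong₂ _,_ (ℤP.+-inverseˡ p) (ℤP.+-inverseˡ q))
             , (λ (p , q) → cong₂ _,_ (ℤP.+-inverseʳ p) (ℤP.+-inverseʳ q))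

  *θ-comm : Commutative _≡_ _*θ_
  *θ-comm (p , q) (r , s) = cong₂ _,_ (first p q r s) (second A p q r s)
    where
    first : ∀ p q r s → p * r + q * s ≡ r * p + s * q
    first = solve-∀
    second : ∀ A p q r s → p * s + q * r + A * (q * s) ≡ r * q + s * p + A * (s * q)
    second = solve-∀

  *θ-assoc : Associative _≡_ _*θ_
  *θ-assoc (p , q) (r , s) (t , u) = cong₂ _,_ (first A p q r s t u) (second A p q r s t u)
    where
    first : ∀ A p q r s t u →
      (p * r + q * s) * t + (p * s + q * r + A * (q * s)) * u ≡
      p * (r * t + s * u) + q * (r * u + s * t + A * (s * u))
    first = solve-∀
    second : ∀ A p q r s t u →
      (p * r + q * s) * u + (p * s + q * r + A * (q * s)) * t + A * ((p * s + q * r + A * (q * s)) * u) ≡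
      p * (r * u + s * t + A * (s * u)) + q * (r * t + s * u) + A * (q * (r * u + s * t + A * (s * u)))
    second = solve-∀

  *θ-identityˡ : LeftIdentity _≡_ 𝟙 _*θ_
  *θ-identityˡ (p , q) = cong₂ _,_ (first p q) (second A p q)
    where
    first : ∀ p q → 1ℤ * p + 0ℤ * q ≡ p
    first = solve-∀
    second : ∀ A p q → 1ℤ * q + 0ℤ * p + A * (0ℤ * q) ≡ q
    second = solve-∀

  *θ-distribˡ : _DistributesOverˡ_ _≡_ _*θ_ _+θ_
  *θ-distribˡ (p , q) (r , s) (t , u) = cong₂ _,_ (first p q r s t u) (second A p q r s t u)
    where
    first : ∀ p q r s t u → p * (r + t) + q * (s + u) ≡ (p * r + q * s) + (p * t + q * u)
    first = solve-∀
    second : ∀ A p q r s t u →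
      p * (s + u) + q * (r + t) + A * (q * (s + u)) ≡
      (p * s + q * r + A * (q * s)) + (p * u + q * t + A * (q * u))
    second = solve-∀

  isCommutativeRing : IsCommutativeRing _≡_ _+θ_ _*θ_ negθ 𝟘 𝟙
  isCommutativeRing = record
    { isRing = record
      { +-isAbelianGroup = record
        { isGroup = record
          { isMonoid = record
            { isSemigroup = record
              { isMagma = record { isEquivalence = isEquivalence ; ∙-cong = cong₂ _+θ_ }
              ; assoc = +θ-assoc }
            ; identity = +θ-identity }
          ; inverse = negθ-inverse
          ; ⁻¹-cong = cong negθ }
        ; comm = +θ-comm }
      ; *-cong = cong₂ _*θ_
      ; *-assoc = *θ-assoc
      ; *-identity = *θ-identityˡ , λ x → trans (*θ-comm x 𝟙) (*θ-identityˡ x)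
      ; distrib = *θ-distribˡ , λ x y z → trans (*θ-comm (y +θ z) x)
                    (trans (*θ-distribˡ x y z) (cong₂ _+θ_ (*θ-comm x y) (*θ-comm x z))) }
    ; *-comm = *θ-comm }

  commutativeRing : CommutativeRing _ _
  commutativeRing = record { isCommutativeRing = isCommutativeRing }

  open CommutativeRing commutativeRing public
    using () renaming (+-identityˡ to +θ-identityˡ; +-identityʳ to +θ-identityʳ;
                       -‿inverseʳ to negθ-inverseʳ; *-identityʳ to *θ-identityʳ;
                       distribʳ to *θ-distribʳ; zeroˡ to *θ-zeroˡ; zeroʳ to *θ-zeroʳ)

  private
    ι-homomorphism : ℤ.+-*-rawRing -Raw-AlmostCommutative⟶ fromCommutativeRing commutativeRing
    ι-homomorphism = record
      { ⟦_⟧ = ι a ; +-homo = λ _ _ → refl ; *-homo = ι-* ; -‿homo = λ _ → refl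
      ; 0-homo = refl ; 1-homo = refl }
      where
      ι-* : ∀ x y → ι a (x * y) ≡ ι a x *θ ι a y
      ι-* x y = cong₂ _,_ (first x y) (second A x y)
        where
        first : ∀ x y → x * y ≡ x * y + 0ℤ * 0ℤ
        first = solve-∀
        second : ∀ A x y → 0ℤ ≡ x * 0ℤ + 0ℤ * y + A * (0ℤ * 0ℤ)
        second = solve-∀

    ι-≟ : ∀ x y → Maybe (ι a x ≡ ι a y)
    ι-≟ x y with x ℤP.≟ y
    ... | yes x≡y = just (cong (ι a) x≡y)
    ... | no _    = nothing

  module Solver = RingSolver ℤ.+-*-rawRing (fromCommutativeRing commutativeRing) ι-homomorphism ι-≟
  open Solver using (solve; _:+_; _:*_; _:-_; _:=_; con)

  ϑ*ϑ⁻¹ : ϑ *θ ϑ⁻¹ ≡ 𝟙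
  ϑ*ϑ⁻¹ = cong₂ _,_ (first A) (second A)
    where
    first : ∀ A → 0ℤ * - A + 1ℤ * 1ℤ ≡ 1ℤ
    first = solve-∀
    second : ∀ A → 0ℤ * 1ℤ + 1ℤ * - A + A * (1ℤ * 1ℤ) ≡ 0ℤ
    second = solve-∀

  ϑ⁻¹*ϑ : ϑ⁻¹ *θ ϑ ≡ 𝟙
  ϑ⁻¹*ϑ = trans (*θ-comm ϑ⁻¹ ϑ) ϑ*ϑ⁻¹

  ϑ≡a+ϑ⁻¹ : ϑ ≡ ⌜ a ⌝ +θ ϑ⁻¹
  ϑ≡a+ϑ⁻¹ = cong₂ _,_ (sym (ℤP.+-inverseʳ A)) refl

  ϑ^-suc : ∀ i → ϑ^ (i + 1ℤ) ≡ ϑ^ i *θ ϑ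
  ϑ^-suc (+ n) rewrite ℕP.+-comm n 1 = *θ-comm ϑ (ϑⁿ n)
  ϑ^-suc -[1+ 0 ] = sym (trans (cong (_*θ ϑ) (*θ-identityʳ ϑ⁻¹)) ϑ⁻¹*ϑ)
  ϑ^-suc -[1+ ℕ.suc m ] = sym (begin
    ϑ⁻¹ *θ ϑ⁻ⁿ (ℕ.suc m) *θ ϑ   ≡⟨ solve 3 (λ s p t → s :* p :* t := s :* t :* p) refl ϑ⁻¹ (ϑ⁻ⁿ (ℕ.suc m)) ϑ ⟩
    ϑ⁻¹ *θ ϑ *θ ϑ⁻ⁿ (ℕ.suc m)   ≡⟨ cong (_*θ ϑ⁻ⁿ (ℕ.suc m)) ϑ⁻¹*ϑ ⟩
    𝟙 *θ ϑ⁻ⁿ (ℕ.suc m)          ≡⟨ *θ-identityˡ _ ⟩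
    ϑ⁻ⁿ (ℕ.suc m)               ∎)
    where open ≡-Reasoning

  ϑ^-pred*ϑ : ∀ i → ϑ^ (i - 1ℤ) *θ ϑ ≡ ϑ^ i
  ϑ^-pred*ϑ i = trans (sym (ϑ^-suc (i - 1ℤ))) (cong ϑ^ (lemma i))
    where
    lemma : ∀ i → i - 1ℤ + 1ℤ ≡ i
    lemma = solve-∀

  ϑ^-pred : ∀ i → ϑ^ (i - 1ℤ) ≡ ϑ^ i *θ ϑ⁻¹
  ϑ^-pred i = begin
    ϑ^ (i - 1ℤ)                ≡⟨ sym (*θ-identityʳ _) ⟩
    ϑ^ (i - 1ℤ) *θ 𝟙           ≡⟨ cong (ϑ^ (i - 1ℤ) *θ_) (sym ϑ*ϑ⁻¹) ⟩
    ϑ^ (i - 1ℤ) *θ (ϑ *θ ϑ⁻¹)  ≡⟨ sym (*θ-assoc (ϑ^ (i - 1ℤ)) ϑ ϑ⁻¹) ⟩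
    ϑ^ (i - 1ℤ) *θ ϑ *θ ϑ⁻¹    ≡⟨ cong (_*θ ϑ⁻¹) (ϑ^-pred*ϑ i) ⟩
    ϑ^ i *θ ϑ⁻¹                ∎
    where open ≡-Reasoning

  ϑ^-rec : ∀ i → ϑ^ (i + 1ℤ) ≡ ⌜ a ⌝ *θ ϑ^ i +θ ϑ^ (i - 1ℤ)
  ϑ^-rec i = begin
    ϑ^ (i + 1ℤ)                      ≡⟨ ϑ^-suc i ⟩
    ϑ^ i *θ ϑ                        ≡⟨ cong (ϑ^ i *θ_) ϑ≡a+ϑ⁻¹ ⟩
    ϑ^ i *θ (⌜ a ⌝ +θ ϑ⁻¹)           ≡⟨ solve 3 (λ p x s → p :* (x :+ s) := x :* p :+ p :* s) refl (ϑ^ i) ⌜ a ⌝ ϑ⁻¹ ⟩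
    ⌜ a ⌝ *θ ϑ^ i +θ ϑ^ i *θ ϑ⁻¹     ≡⟨ cong (⌜ a ⌝ *θ ϑ^ i +θ_) (sym (ϑ^-pred i)) ⟩
    ⌜ a ⌝ *θ ϑ^ i +θ ϑ^ (i - 1ℤ)     ∎
    where open ≡-Reasoning

  ϑ⁻ⁿ*ϑⁿ : ∀ n → ϑ⁻ⁿ n *θ ϑⁿ n ≡ 𝟙
  ϑ⁻ⁿ*ϑⁿ ℕ.zero    = *θ-identityˡ 𝟙
  ϑ⁻ⁿ*ϑⁿ (ℕ.suc n) = begin
    ϑ⁻¹ *θ ϑ⁻ⁿ n *θ (ϑ *θ ϑⁿ n)      ≡⟨ solve 4 (λ s p t q → s :* p :* (t :* q) := s :* t :* (p :* q)) refl ϑ⁻¹ (ϑ⁻ⁿ n) ϑ (ϑⁿ n) ⟩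
    ϑ⁻¹ *θ ϑ *θ (ϑ⁻ⁿ n *θ ϑⁿ n)      ≡⟨ cong₂ _*θ_ ϑ⁻¹*ϑ (ϑ⁻ⁿ*ϑⁿ n) ⟩
    𝟙 *θ 𝟙                           ≡⟨ *θ-identityˡ 𝟙 ⟩
    𝟙                                ∎
    where open ≡-Reasoning

  ϑ^-neg : ∀ n → ϑ^ (- + n) ≡ ϑ⁻ⁿ n
  ϑ^-neg ℕ.zero    = refl
  ϑ^-neg (ℕ.suc n) = refl

  -- Nonnegativity

  -- The algebraic stand-in for 0 ≤ x (recall θ > 0): some θⁿ x lies in ℕ + ℕθ.
  record Nonneg (x : ℤθ) : Set where
    constructor nonneg
    field
      {exponent} P Q : ℕ
      shifted : x *θ ϑⁿ exponent ≡ (+ P , + Q)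

  record Pos (x : ℤθ) : Set where
    constructor pos
    field
      {exponent} P Q : ℕ
      shifted : x *θ ϑⁿ exponent ≡ (+ P , + Q)
      nonzero : 0 ℕ.< P ℕ.+ Q

  natural*ϑ : ∀ P Q → (+ P , + Q) *θ ϑ ≡ (+ Q , + (P ℕ.+ a ℕ.* Q))
  natural*ϑ P Q = cong₂ _,_ (first (+ P) (+ Q)) (trans (second A (+ P) (+ Q))
    (trans (cong (_+_ (+ P)) (sym (ℤP.pos-* a Q))) (sym (ℤP.pos-+ P (a ℕ.* Q)))))
    where
    first : ∀ P Q → P * 0ℤ + Q * 1ℤ ≡ Q
    first = solve-∀
    second : ∀ A P Q → P * 1ℤ + Q * 0ℤ + A * (Q * 1ℤ) ≡ P + A * Q
    second = solve-∀

  natural-shift : ∀ k x n {P Q} → x *θ ϑⁿ n ≡ (+ P , + Q) →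
                  ∃[ P′ ] ∃[ Q′ ] x *θ ϑⁿ (k ℕ.+ n) ≡ (+ P′ , + Q′) × P ℕ.+ Q ℕ.≤ P′ ℕ.+ Q′
  natural-shift ℕ.zero    x n eq = _ , _ , eq , ℕP.≤-refl
  natural-shift (ℕ.suc k) x n eq with natural-shift k x n eq
  ... | P , Q , eq′ , le = Q , P ℕ.+ a ℕ.* Q , shifted , ℕP.≤-trans le grows
    where
    open ≡-Reasoning
    shifted : x *θ (ϑ *θ ϑⁿ (k ℕ.+ n)) ≡ (+ Q , + (P ℕ.+ a ℕ.* Q))
    shifted = begin
      x *θ (ϑ *θ ϑⁿ (k ℕ.+ n))  ≡⟨ solve 3 (λ x t p → x :* (t :* p) := x :* p :* t) refl x ϑ (ϑⁿ (k ℕ.+ n)) ⟩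
      x *θ ϑⁿ (k ℕ.+ n) *θ ϑ    ≡⟨ cong (_*θ ϑ) eq′ ⟩
      (+ P , + Q) *θ ϑ          ≡⟨ natural*ϑ P Q ⟩
      (+ Q , + (P ℕ.+ a ℕ.* Q)) ∎
    grows : P ℕ.+ Q ℕ.≤ Q ℕ.+ (P ℕ.+ a ℕ.* Q)
    grows = ℕP.≤-trans (ℕP.≤-reflexive (ℕP.+-comm P Q)) (ℕP.+-monoʳ-≤ Q (ℕP.m≤m+n P (a ℕ.* Q)))

  private
    natural-+ : ∀ x y n {P Q R S} → x *θ ϑⁿ n ≡ (+ P , + Q) → y *θ ϑⁿ n ≡ (+ R , + S) →
                (x +θ y) *θ ϑⁿ n ≡ (+ (P ℕ.+ R) , + (Q ℕ.+ S))
    natural-+ x y n {P} {Q} {R} {S} ex ey = begin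
      (x +θ y) *θ ϑⁿ n             ≡⟨ *θ-distribʳ (ϑⁿ n) x y ⟩
      x *θ ϑⁿ n +θ y *θ ϑⁿ n       ≡⟨ cong₂ _+θ_ ex ey ⟩
      (+ P + + R , + Q + + S)      ≡⟨ sym (cong₂ _,_ (ℤP.pos-+ P R) (ℤP.pos-+ Q S)) ⟩
      (+ (P ℕ.+ R) , + (Q ℕ.+ S))  ∎
      where open ≡-Reasoning

    natural-+-shifted : ∀ x y n m {P Q R S} → x *θ ϑⁿ n ≡ (+ P , + Q) → y *θ ϑⁿ m ≡ (+ R , + S) →
      ∃[ P′ ] ∃[ Q′ ] (x +θ y) *θ ϑⁿ (m ℕ.+ n) ≡ (+ P′ , + Q′) × P ℕ.+ Q ℕ.≤ P′ ℕ.+ Q′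
    natural-+-shifted x y n m ex ey with natural-shift m x n ex | natural-shift n y m ey
    ... | P′ , Q′ , ex′ , le | R′ , S′ , ey′ , _ =
      P′ ℕ.+ R′ , Q′ ℕ.+ S′ ,
      natural-+ x y (m ℕ.+ n) ex′ (subst (λ k → y *θ ϑⁿ k ≡ (+ R′ , + S′)) (ℕP.+-comm n m) ey′) ,
      ℕP.≤-trans le (ℕP.+-mono-≤ (ℕP.m≤m+n P′ R′) (ℕP.m≤m+n Q′ S′))

  nonneg-+ : ∀ {x y} → Nonneg x → Nonneg y → Nonneg (x +θ y)
  nonneg-+ {x} {y} (nonneg {n} _ _ ex) (nonneg {m} _ _ ey) = build (natural-+-shifted x y n m ex ey)
    where
    build : ∃[ P ] ∃[ Q ] (x +θ y) *θ ϑⁿ (m ℕ.+ n) ≡ (+ P , + Q) × _ → Nonneg (x +θ y)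
    build (P , Q , eq , _) = nonneg {exponent = m ℕ.+ n} P Q eq

  pos-+ : ∀ {x y} → Pos x → Nonneg y → Pos (x +θ y)
  pos-+ {x} {y} (pos {n} P Q ex 0<P+Q) (nonneg {m} _ _ ey) = build (natural-+-shifted x y n m ex ey)
    where
    build : ∃[ P′ ] ∃[ Q′ ] (x +θ y) *θ ϑⁿ (m ℕ.+ n) ≡ (+ P′ , + Q′) × P ℕ.+ Q ℕ.≤ P′ ℕ.+ Q′ → Pos (x +θ y)
    build (P′ , Q′ , eq , le) = pos {exponent = m ℕ.+ n} P′ Q′ eq (ℕP.<-≤-trans 0<P+Q le)

  nonneg-+-pos : ∀ {x y} → Nonneg x → Pos y → Pos (x +θ y)
  nonneg-+-pos {x} {y} nx py = subst Pos (+θ-comm y x) (pos-+ py nx)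

  pos⇒nonneg : ∀ {x} → Pos x → Nonneg x
  pos⇒nonneg (pos {n} P Q eq _) = nonneg {exponent = n} P Q eq

  pos⇒≢𝟘 : ∀ {x} → Pos x → x ≢ 𝟘
  pos⇒≢𝟘 (pos {n} P Q eq 0<P+Q) refl = ℕP.<-irrefl refl (subst (0 ℕ.<_) (cong₂ ℕ._+_ P≡0 Q≡0) 0<P+Q)
    where
    𝟘≡PQ : 𝟘 ≡ (+ P , + Q)
    𝟘≡PQ = trans (sym (*θ-zeroˡ (ϑⁿ n))) eq
    P≡0 : P ≡ 0
    P≡0 = sym (ℤP.+-injective (cong proj₁ 𝟘≡PQ))
    Q≡0 : Q ≡ 0
    Q≡0 = sym (ℤP.+-injective (cong proj₂ 𝟘≡PQ))

  nonneg-𝟘 : Nonneg 𝟘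
  nonneg-𝟘 = nonneg {exponent = 0} 0 0 (*θ-zeroˡ 𝟙)

  pos-ϑ^ : ∀ i → Pos (ϑ^ i)
  pos-ϑ^ (+ n) with natural-shift n 𝟙 0 (*θ-identityˡ 𝟙)
  ... | P , Q , eq , le = pos {exponent = 0} P Q (begin
    ϑⁿ n *θ 𝟙        ≡⟨ *θ-identityʳ (ϑⁿ n) ⟩
    ϑⁿ n             ≡⟨ cong ϑⁿ (sym (ℕP.+-identityʳ n)) ⟩
    ϑⁿ (n ℕ.+ 0)     ≡⟨ sym (*θ-identityˡ _) ⟩
    𝟙 *θ ϑⁿ (n ℕ.+ 0) ≡⟨ eq ⟩
    (+ P , + Q)      ∎) le
    where open ≡-Reasoning
  pos-ϑ^ -[1+ n ] = pos {exponent = ℕ.suc n} 1 0 (ϑ⁻ⁿ*ϑⁿ (ℕ.suc n)) ℕP.≤-refl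

  nonneg-digit : ∀ c i → Nonneg (⌜ c ⌝ *θ ϑ^ i)
  nonneg-digit c i with pos-ϑ^ i
  ... | pos {n} P Q eq _ = nonneg {exponent = n} (c ℕ.* P) (c ℕ.* Q) (begin
    ⌜ c ⌝ *θ ϑ^ i *θ ϑⁿ n            ≡⟨ *θ-assoc ⌜ c ⌝ (ϑ^ i) (ϑⁿ n) ⟩
    ⌜ c ⌝ *θ (ϑ^ i *θ ϑⁿ n)          ≡⟨ cong (⌜ c ⌝ *θ_) eq ⟩
    ⌜ c ⌝ *θ (+ P , + Q)             ≡⟨ cong₂ _,_ (first (+ c) (+ P) (+ Q)) (second A (+ c) (+ P) (+ Q)) ⟩
    (+ c * + P , + c * + Q)          ≡⟨ sym (cong₂ _,_ (ℤP.pos-* c P) (ℤP.pos-* c Q)) ⟩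
    (+ (c ℕ.* P) , + (c ℕ.* Q))      ∎)
    where
    open ≡-Reasoning
    first : ∀ c P Q → c * P + 0ℤ * Q ≡ c * P
    first = solve-∀
    second : ∀ A c P Q → c * Q + 0ℤ * P + A * (0ℤ * Q) ≡ c * Q
    second = solve-∀

  digitSum : (ℤ → ℕ) → ℤ → ℕ → ℤθ
  digitSum = partialFrom a

  private
    agree-uncons : ∀ (d e : ℤ → ℕ) m L → (∀ k → k ℕ.< ℕ.suc L → d (m + + k) ≡ e (m + + k)) →
                  (d m ≡ e m) × (∀ k → k ℕ.< L → d (m + 1ℤ + + k) ≡ e (m + 1ℤ + + k))
    agree-uncons d e m L agree =
        subst (λ i → d i ≡ e i) (ℤP.+-identityʳ m) (agree 0 (ℕ.s≤s ℕ.z≤n))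
      , λ k k<L → subst (λ i → d i ≡ e i) (sym (i+1+n≡i+[1+n] m k)) (agree (ℕ.suc k) (ℕ.s≤s k<L))

  digitSum-split : ∀ d m L K → digitSum d m (L ℕ.+ K) ≡ digitSum d m L +θ digitSum d (m + + L) K
  digitSum-split d m ℕ.zero K =
    trans (cong (λ i → digitSum d i K) (sym (ℤP.+-identityʳ m))) (sym (+θ-identityˡ _))
  digitSum-split d m (ℕ.suc L) K = begin
    t +θ digitSum d (m + 1ℤ) (L ℕ.+ K)                             ≡⟨ cong (t +θ_) (digitSum-split d (m + 1ℤ) L K) ⟩
    t +θ (digitSum d (m + 1ℤ) L +θ digitSum d (m + 1ℤ + + L) K)    ≡⟨ cong (λ i → t +θ (digitSum d (m + 1ℤ) L +θ digitSum d i K)) (i+1+n≡i+[1+n] m L) ⟩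
    t +θ (digitSum d (m + 1ℤ) L +θ digitSum d (m + + ℕ.suc L) K)   ≡⟨ sym (+θ-assoc t _ _) ⟩
    t +θ digitSum d (m + 1ℤ) L +θ digitSum d (m + + ℕ.suc L) K     ∎
    where
    open ≡-Reasoning
    t = ⌜ d m ⌝ *θ ϑ^ m

  digitSum-snoc : ∀ d m L → digitSum d m (ℕ.suc L) ≡ digitSum d m L +θ ⌜ d (m + + L) ⌝ *θ ϑ^ (m + + L)
  digitSum-snoc d m L = begin
    digitSum d m (ℕ.suc L)                                         ≡⟨ cong (digitSum d m) (ℕP.+-comm 1 L) ⟩
    digitSum d m (L ℕ.+ 1)                                         ≡⟨ digitSum-split d m L 1 ⟩
    digitSum d m L +θ (⌜ d (m + + L) ⌝ *θ ϑ^ (m + + L) +θ 𝟘)       ≡⟨ cong (digitSum d m L +θ_) (+θ-identityʳ _) ⟩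
    digitSum d m L +θ ⌜ d (m + + L) ⌝ *θ ϑ^ (m + + L)              ∎
    where open ≡-Reasoning

  digitSum-cong : ∀ d e m L → (∀ k → k ℕ.< L → d (m + + k) ≡ e (m + + k)) → digitSum d m L ≡ digitSum e m L
  digitSum-cong d e m ℕ.zero    agree = refl
  digitSum-cong d e m (ℕ.suc L) agree with agree-uncons d e m L agree
  ... | here , rest = cong₂ _+θ_ (cong (λ c → ⌜ c ⌝ *θ ϑ^ m) here) (digitSum-cong d e (m + 1ℤ) L rest)

  digitSum-zero : ∀ d m L → (∀ k → k ℕ.< L → d (m + + k) ≡ 0) → digitSum d m L ≡ 𝟘
  digitSum-zero d m L vanish = trans (digitSum-cong d (λ _ → 0) m L vanish) (zeros m L)
    where
    zeros : ∀ m L → digitSum (λ _ → 0) m L ≡ 𝟘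
    zeros m ℕ.zero    = refl
    zeros m (ℕ.suc L) = trans (cong₂ _+θ_ (*θ-zeroˡ (ϑ^ m)) (zeros (m + 1ℤ) L)) (+θ-identityˡ 𝟘)

  digitSum-+ : ∀ d e m L → digitSum (λ i → d i ℕ.+ e i) m L ≡ digitSum d m L +θ digitSum e m L
  digitSum-+ d e m ℕ.zero    = sym (+θ-identityˡ 𝟘)
  digitSum-+ d e m (ℕ.suc L) = begin
    ⌜ d m ℕ.+ e m ⌝ *θ ϑ^ m +θ digitSum (λ i → d i ℕ.+ e i) (m + 1ℤ) L
      ≡⟨ cong₂ _+θ_ (cong (_*θ ϑ^ m) (⌜+⌝ (d m) (e m))) (digitSum-+ d e (m + 1ℤ) L) ⟩
    (⌜ d m ⌝ +θ ⌜ e m ⌝) *θ ϑ^ m +θ (digitSum d (m + 1ℤ) L +θ digitSum e (m + 1ℤ) L)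
      ≡⟨ solve 5 (λ x y p u v → (x :+ y) :* p :+ (u :+ v) := (x :* p :+ u) :+ (y :* p :+ v)) refl
               ⌜ d m ⌝ ⌜ e m ⌝ (ϑ^ m) (digitSum d (m + 1ℤ) L) (digitSum e (m + 1ℤ) L) ⟩
    digitSum d m (ℕ.suc L) +θ digitSum e m (ℕ.suc L) ∎
    where open ≡-Reasoning

  digitSum-nonneg : ∀ d m L → Nonneg (digitSum d m L)
  digitSum-nonneg d m ℕ.zero    = nonneg-𝟘
  digitSum-nonneg d m (ℕ.suc L) = nonneg-+ (nonneg-digit (d m) m) (digitSum-nonneg d (m + 1ℤ) L)

  evalDigits-nonneg : ∀ m bs → Nonneg (evalDigits a m bs)
  evalDigits-nonneg m []       = nonneg-𝟘
  evalDigits-nonneg m (b ∷ bs) = nonneg-+ (nonneg-digit b m) (evalDigits-nonneg (m + 1ℤ) bs)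

  -- Greedy digit functions: the upper bound and uniqueness

  record IsGreedy (d : ℤ → ℕ) : Set where
    field
      bounded    : ∀ i → d i ℕ.≤ a
      admissible : ∀ i → d (i + 1ℤ) ≡ a → d i ≡ 0

  -- Greedy digits on [m, m + L) sum to less than θ^(m + L): a top digit below a leaves room
  -- θ^(T - 1) since θ^(T + 1) = a θ^T + θ^(T - 1), and a top digit a is followed by a 0.
  digitSum<ϑ^ : ∀ {d} → IsGreedy d → ∀ m L → Pos (ϑ^ (m + + L) -θ digitSum d m L)
  digitSum<ϑ^ {d} g m L = proj₁ (consecutive L)
    where
    open IsGreedy g
    open ≡-Reasoning

    gap : ℕ → ℤθ
    gap L = ϑ^ (m + + L) -θ digitSum d m L

    step : ∀ L → Pos (gap L) → (d (m + + L) ≡ a → Pos (ϑ^ (m + + L - 1ℤ) -θ digitSum d m L)) → Pos (gap (ℕ.suc L))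
    step L gapL topIsA with ℕP.m≤n⇒m<n∨m≡n (bounded (m + + L))
    ... | inj₁ c<a = subst Pos (sym split) (nonneg-+-pos (nonneg-digit r T) (pos-+ (pos-ϑ^ (T - 1ℤ)) (pos⇒nonneg gapL)))
      where
      T = m + + L
      c = d T
      r = a ℕ.∸ ℕ.suc c
      split : gap (ℕ.suc L) ≡ ⌜ r ⌝ *θ ϑ^ T +θ (ϑ^ (T - 1ℤ) +θ gap L)
      split = begin
        ϑ^ (m + + ℕ.suc L) -θ digitSum d m (ℕ.suc L)      ≡⟨ cong₂ _-θ_ (cong ϑ^ (i+[1+n]≡i+n+1 m L)) (digitSum-snoc d m L) ⟩
        ϑ^ (T + 1ℤ) -θ (digitSum d m L +θ ⌜ c ⌝ *θ ϑ^ T)  ≡⟨ cong (_-θ (digitSum d m L +θ ⌜ c ⌝ *θ ϑ^ T)) (ϑ^-rec T) ⟩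
        ⌜ a ⌝ *θ ϑ^ T +θ ϑ^ (T - 1ℤ) -θ (digitSum d m L +θ ⌜ c ⌝ *θ ϑ^ T)
          ≡⟨ cong (λ n → ⌜ n ⌝ *θ ϑ^ T +θ ϑ^ (T - 1ℤ) -θ (digitSum d m L +θ ⌜ c ⌝ *θ ϑ^ T))
                  (sym (ℕP.m+[n∸m]≡n c<a)) ⟩
        ⌜ ℕ.suc c ℕ.+ r ⌝ *θ ϑ^ T +θ ϑ^ (T - 1ℤ) -θ (digitSum d m L +θ ⌜ c ⌝ *θ ϑ^ T)
          ≡⟨ cong (λ x → x *θ ϑ^ T +θ ϑ^ (T - 1ℤ) -θ (digitSum d m L +θ ⌜ c ⌝ *θ ϑ^ T))
                  (trans (⌜+⌝ (ℕ.suc c) r) (cong (_+θ ⌜ r ⌝) (⌜suc⌝ c))) ⟩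
        (𝟙 +θ ⌜ c ⌝ +θ ⌜ r ⌝) *θ ϑ^ T +θ ϑ^ (T - 1ℤ) -θ (digitSum d m L +θ ⌜ c ⌝ *θ ϑ^ T)
          ≡⟨ solve 5 (λ x y p q s → (con 1ℤ :+ x :+ y) :* p :+ q :- (s :+ x :* p) := y :* p :+ (q :+ (p :- s)))
                   refl ⌜ c ⌝ ⌜ r ⌝ (ϑ^ T) (ϑ^ (T - 1ℤ)) (digitSum d m L) ⟩
        ⌜ r ⌝ *θ ϑ^ T +θ (ϑ^ (T - 1ℤ) +θ gap L)           ∎
    ... | inj₂ c≡a = subst Pos (sym split) (topIsA c≡a)
      where
      T = m + + L
      split : gap (ℕ.suc L) ≡ ϑ^ (T - 1ℤ) -θ digitSum d m L
      split = begin
        ϑ^ (m + + ℕ.suc L) -θ digitSum d m (ℕ.suc L)      ≡⟨ cong₂ _-θ_ (cong ϑ^ (i+[1+n]≡i+n+1 m L)) (digitSum-snoc d m L) ⟩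
        ϑ^ (T + 1ℤ) -θ (digitSum d m L +θ ⌜ d T ⌝ *θ ϑ^ T) ≡⟨ cong₂ (λ x c → x -θ (digitSum d m L +θ ⌜ c ⌝ *θ ϑ^ T)) (ϑ^-rec T) c≡a ⟩
        ⌜ a ⌝ *θ ϑ^ T +θ ϑ^ (T - 1ℤ) -θ (digitSum d m L +θ ⌜ a ⌝ *θ ϑ^ T)
          ≡⟨ solve 4 (λ x p q s → x :* p :+ q :- (s :+ x :* p) := q :- s) refl ⌜ a ⌝ (ϑ^ T) (ϑ^ (T - 1ℤ)) (digitSum d m L) ⟩
        ϑ^ (T - 1ℤ) -θ digitSum d m L                      ∎

    consecutive : ∀ L → Pos (gap L) × Pos (gap (ℕ.suc L))
    consecutive ℕ.zero = gap0 , step 0 gap0 (λ _ → subst Pos (sym (+θ-identityʳ _)) (pos-ϑ^ (m + + 0 - 1ℤ)))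
      where
      gap0 : Pos (gap 0)
      gap0 = subst Pos (trans (cong ϑ^ (sym (ℤP.+-identityʳ m))) (sym (+θ-identityʳ _))) (pos-ϑ^ m)
    consecutive (ℕ.suc L) with consecutive L
    ... | gapL , gapL+1 = gapL+1 , step (ℕ.suc L) gapL+1 belowIsZero
      where
      belowIsZero : d (m + + ℕ.suc L) ≡ a → Pos (ϑ^ (m + + ℕ.suc L - 1ℤ) -θ digitSum d m (ℕ.suc L))
      belowIsZero topIsA = subst Pos (sym (begin
        ϑ^ (m + + ℕ.suc L - 1ℤ) -θ digitSum d m (ℕ.suc L)
          ≡⟨ cong₂ _-θ_ (cong ϑ^ (i+[1+n]-1≡i+n m L)) (digitSum-snoc d m L) ⟩
        ϑ^ (m + + L) -θ (digitSum d m L +θ ⌜ d (m + + L) ⌝ *θ ϑ^ (m + + L))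
          ≡⟨ cong (λ c → ϑ^ (m + + L) -θ (digitSum d m L +θ ⌜ c ⌝ *θ ϑ^ (m + + L))) digitBelowIsZero ⟩
        ϑ^ (m + + L) -θ (digitSum d m L +θ 𝟘 *θ ϑ^ (m + + L))
          ≡⟨ solve 3 (λ p s q → p :- (s :+ con 0ℤ :* q) := p :- s) refl (ϑ^ (m + + L)) (digitSum d m L) (ϑ^ (m + + L)) ⟩
        gap L ∎)) gapL
        where
        digitBelowIsZero : d (m + + L) ≡ 0
        digitBelowIsZero = admissible (m + + L) (subst (λ i → d i ≡ a) (i+[1+n]≡i+n+1 m L) topIsA)

  private
    smaller-top-digit : ∀ {d} → IsGreedy d → ∀ m L c δ s → Nonneg s →
      digitSum d m L +θ ⌜ c ⌝ *θ ϑ^ (m + + L) ≢ s +θ ⌜ ℕ.suc (c ℕ.+ δ) ⌝ *θ ϑ^ (m + + L)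
    smaller-top-digit {d} g m L c δ s s≥0 eq = pos⇒≢𝟘 positive (begin
      s +θ (⌜ δ ⌝ *θ p +θ (p -θ S))                                ≡⟨ solve 5 (λ s S p c δ → s :+ (δ :* p :+ (p :- S)) := (s :+ (con 1ℤ :+ c :+ δ) :* p) :- (S :+ c :* p)) refl s S p ⌜ c ⌝ ⌜ δ ⌝ ⟩
      s +θ (𝟙 +θ ⌜ c ⌝ +θ ⌜ δ ⌝) *θ p -θ (S +θ ⌜ c ⌝ *θ p)          ≡⟨ cong (λ x → s +θ x *θ p -θ (S +θ ⌜ c ⌝ *θ p)) (sym (trans (⌜+⌝ (ℕ.suc c) δ) (cong (_+θ ⌜ δ ⌝) (⌜suc⌝ c)))) ⟩
      s +θ ⌜ ℕ.suc (c ℕ.+ δ) ⌝ *θ p -θ (S +θ ⌜ c ⌝ *θ p)            ≡⟨ cong (_-θ (S +θ ⌜ c ⌝ *θ p)) (sym eq) ⟩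
      S +θ ⌜ c ⌝ *θ p -θ (S +θ ⌜ c ⌝ *θ p)                         ≡⟨ negθ-inverseʳ (S +θ ⌜ c ⌝ *θ p) ⟩
      𝟘                                                            ∎)
      where
      open ≡-Reasoning
      p = ϑ^ (m + + L)
      S = digitSum d m L
      positive : Pos (s +θ (⌜ δ ⌝ *θ p +θ (p -θ S)))
      positive = nonneg-+-pos s≥0 (nonneg-+-pos (nonneg-digit δ (m + + L)) (digitSum<ϑ^ g m L))

  +θ-cancelʳ : ∀ x y t → x +θ t ≡ y +θ t → x ≡ y
  +θ-cancelʳ x y t eq = begin
    x            ≡⟨ solve 2 (λ x t → x := x :+ t :- t) refl x t ⟩
    x +θ t -θ t  ≡⟨ cong (_-θ t) eq ⟩
    y +θ t -θ t  ≡⟨ solve 2 (λ y t → y :+ t :- t := y) refl y t ⟩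
    y            ∎
    where open ≡-Reasoning

  digitSum-injective : ∀ {d e} → IsGreedy d → IsGreedy e → ∀ m L → digitSum d m L ≡ digitSum e m L →
                       ∀ k → k ℕ.< L → d (m + + k) ≡ e (m + + k)
  digitSum-injective {d} {e} gd ge m (ℕ.suc L) eq k k<L+1 = agree (ℕP.m≤n⇒m<n∨m≡n (ℕP.≤-pred k<L+1))
    where
    T = m + + L
    split : digitSum d m L +θ ⌜ d T ⌝ *θ ϑ^ T ≡ digitSum e m L +θ ⌜ e T ⌝ *θ ϑ^ T
    split = trans (sym (digitSum-snoc d m L)) (trans eq (digitSum-snoc e m L))
    top : d T ≡ e T
    top with ℕP.<-cmp (d T) (e T)
    ... | tri≈ _ same _ = same
    ... | tri< d<e _ _  = ⊥-elim (smaller-top-digit gd m L (d T) (e T ℕ.∸ ℕ.suc (d T)) _ (digitSum-nonneg e m L)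
                            (subst (λ c → digitSum d m L +θ ⌜ d T ⌝ *θ ϑ^ T ≡ digitSum e m L +θ ⌜ c ⌝ *θ ϑ^ T) (sym (ℕP.m+[n∸m]≡n d<e)) split))
    ... | tri> _ _ e<d  = ⊥-elim (smaller-top-digit ge m L (e T) (d T ℕ.∸ ℕ.suc (e T)) _ (digitSum-nonneg d m L)
                            (subst (λ c → digitSum e m L +θ ⌜ e T ⌝ *θ ϑ^ T ≡ digitSum d m L +θ ⌜ c ⌝ *θ ϑ^ T) (sym (ℕP.m+[n∸m]≡n e<d)) (sym split)))
    lower : digitSum d m L ≡ digitSum e m L
    lower = +θ-cancelʳ _ _ (⌜ e T ⌝ *θ ϑ^ T) (subst (λ c → digitSum d m L +θ ⌜ c ⌝ *θ ϑ^ T ≡ digitSum e m L +θ ⌜ e T ⌝ *θ ϑ^ T) top split)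
    agree : k ℕ.< L ⊎ k ≡ L → d (m + + k) ≡ e (m + + k)
    agree (inj₁ k<L)  = digitSum-injective gd ge m L lower k k<L
    agree (inj₂ refl) = top

  VanishesOutside : (ℤ → ℕ) → ℤ → ℤ → Set
  VanishesOutside d lo hi = ∀ i → i ℤ.< lo ⊎ hi ℤ.≤ i → d i ≡ 0

  vanishesOutside-widen : ∀ {d lo hi lo′ hi′} → lo′ ℤ.≤ lo → hi ℤ.≤ hi′ →
                          VanishesOutside d lo hi → VanishesOutside d lo′ hi′
  vanishesOutside-widen lo′≤lo hi≤hi′ vanish i (inj₁ i<lo′) = vanish i (inj₁ (ℤP.<-≤-trans i<lo′ lo′≤lo))
  vanishesOutside-widen lo′≤lo hi≤hi′ vanish i (inj₂ hi′≤i) = vanish i (inj₂ (ℤP.≤-trans hi≤hi′ hi′≤i))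

  digitSum-window : ∀ d {l L w K} → VanishesOutside d l (l + + L) → w ℤ.≤ l → l + + L ℤ.≤ w + + K →
                    digitSum d w K ≡ digitSum d l L
  digitSum-window d {l} {L} {w} {K} vanish w≤l top≤ = begin
    digitSum d w K                                          ≡⟨ cong (digitSum d w) K≡D+L+R ⟩
    digitSum d w (D ℕ.+ (L ℕ.+ R))                          ≡⟨ digitSum-split d w D (L ℕ.+ R) ⟩
    digitSum d w D +θ digitSum d (w + + D) (L ℕ.+ R)        ≡⟨ cong (λ i → digitSum d w D +θ digitSum d i (L ℕ.+ R)) (sym l≡w+D) ⟩
    digitSum d w D +θ digitSum d l (L ℕ.+ R)                ≡⟨ cong (digitSum d w D +θ_) (digitSum-split d l L R) ⟩
    digitSum d w D +θ (digitSum d l L +θ digitSum d (l + + L) R)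
      ≡⟨ cong₂ (λ x y → x +θ (digitSum d l L +θ y)) zeros-below zeros-above ⟩
    𝟘 +θ (digitSum d l L +θ 𝟘)                              ≡⟨ trans (+θ-identityˡ _) (+θ-identityʳ _) ⟩
    digitSum d l L                                          ∎
    where
    open ≡-Reasoning
    D = ℤ.∣ w - l ∣
    R = ℤ.∣ l + + L - (w + + K) ∣
    l≡w+D : l ≡ w + + D
    l≡w+D = i≤j⇒j≡i+∣i-j∣ w≤l
    K≡D+L+R : K ≡ D ℕ.+ (L ℕ.+ R)
    K≡D+L+R = ℤP.+-injective (begin
      + K                                  ≡⟨ lemma w (+ K) ⟩
      w + + K - w                          ≡⟨ cong (_- w) (i≤j⇒j≡i+∣i-j∣ top≤) ⟩
      l + + L + + R - w                    ≡⟨ cong (λ l → l + + L + + R - w) l≡w+D ⟩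
      w + + D + + L + + R - w              ≡⟨ sym (lemma′ w (+ D) (+ L) (+ R)) ⟩
      + D + (+ L + + R)                    ≡⟨ cong (_+_ (+ D)) (sym (ℤP.pos-+ L R)) ⟩
      + D + + (L ℕ.+ R)                    ≡⟨ sym (ℤP.pos-+ D (L ℕ.+ R)) ⟩
      + (D ℕ.+ (L ℕ.+ R))                  ∎)
      where
      lemma : ∀ w K → K ≡ w + K - w
      lemma = solve-∀
      lemma′ : ∀ w D L R → D + (L + R) ≡ w + D + L + R - w
      lemma′ = solve-∀
    zeros-below : digitSum d w D ≡ 𝟘
    zeros-below = digitSum-zero d w D (λ k k<D → vanish _ (inj₁ (subst (w + + k ℤ.<_) (sym l≡w+D) (i+m<i+n w k<D))))
    zeros-above : digitSum d (l + + L) R ≡ 𝟘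
    zeros-above = digitSum-zero d (l + + L) R (λ k _ → vanish _ (inj₂ (i≤i+n (l + + L) k)))

  private
    window-position : ∀ w K i → i ℤ.< w ⊎ (∃[ k ] k ℕ.< K × i ≡ w + + k) ⊎ w + + K ℤ.≤ i
    window-position w K i with i ℤP.<? w
    ... | yes i<w = inj₁ i<w
    ... | no  i≮w with ℤ.∣ w - i ∣ ℕP.<? K
    ...   | yes k<K = inj₂ (inj₁ (ℤ.∣ w - i ∣ , k<K , i≤j⇒j≡i+∣i-j∣ (ℤP.≮⇒≥ i≮w)))
    ...   | no  k≮K = inj₂ (inj₂ (subst (w + + K ℤ.≤_) (sym (i≤j⇒j≡i+∣i-j∣ (ℤP.≮⇒≥ i≮w)))
                                    (ℤP.+-monoʳ-≤ w (ℤ.+≤+ (ℕP.≮⇒≥ k≮K)))))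

    greedy-unique-window : ∀ {d e} → IsGreedy d → IsGreedy e → ∀ w K →
      VanishesOutside d w (w + + K) → VanishesOutside e w (w + + K) →
      digitSum d w K ≡ digitSum e w K → ∀ i → d i ≡ e i
    greedy-unique-window gd ge w K dv ev eq i with window-position w K i
    ... | inj₁ i<w              = trans (dv i (inj₁ i<w)) (sym (ev i (inj₁ i<w)))
    ... | inj₂ (inj₁ (k , k<K , refl)) = digitSum-injective gd ge w K eq k k<K
    ... | inj₂ (inj₂ top≤i)      = trans (dv i (inj₂ top≤i)) (sym (ev i (inj₂ top≤i)))

  private
    module CommonWindow (l₁ : ℤ) (L₁ : ℕ) (l₂ : ℤ) (L₂ : ℕ) where
      h₁ = l₁ + + L₁
      h₂ = l₂ + + L₂
      w = l₁ ℤ.⊓ l₂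
      K = ℤ.∣ w - (h₁ ℤ.⊔ h₂) ∣

      top≡w+K : h₁ ℤ.⊔ h₂ ≡ w + + K
      top≡w+K = i≤j⇒j≡i+∣i-j∣ (ℤP.≤-trans (ℤP.≤-trans (ℤP.i⊓j≤i l₁ l₂) (i≤i+n l₁ L₁)) (ℤP.i≤i⊔j h₁ h₂))

      widen₁ : ∀ {d} → VanishesOutside d l₁ h₁ → VanishesOutside d w (w + + K)
      widen₁ = vanishesOutside-widen (ℤP.i⊓j≤i l₁ l₂) (subst (h₁ ℤ.≤_) top≡w+K (ℤP.i≤i⊔j h₁ h₂))

      widen₂ : ∀ {d} → VanishesOutside d l₂ h₂ → VanishesOutside d w (w + + K)
      widen₂ = vanishesOutside-widen (ℤP.i⊓j≤j l₁ l₂) (subst (h₂ ℤ.≤_) top≡w+K (ℤP.i≤j⊔i h₁ h₂))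

      sum₁ : ∀ d → VanishesOutside d l₁ h₁ → digitSum d w K ≡ digitSum d l₁ L₁
      sum₁ d v = digitSum-window d v (ℤP.i⊓j≤i l₁ l₂) (subst (h₁ ℤ.≤_) top≡w+K (ℤP.i≤i⊔j h₁ h₂))

      sum₂ : ∀ d → VanishesOutside d l₂ h₂ → digitSum d w K ≡ digitSum d l₂ L₂
      sum₂ d v = digitSum-window d v (ℤP.i⊓j≤j l₁ l₂) (subst (h₂ ℤ.≤_) top≡w+K (ℤP.i≤j⊔i h₁ h₂))

  digitSum-window-indep : ∀ d {l₁ L₁ l₂ L₂} → VanishesOutside d l₁ (l₁ + + L₁) → VanishesOutside d l₂ (l₂ + + L₂) →
                          digitSum d l₁ L₁ ≡ digitSum d l₂ L₂
  digitSum-window-indep d {l₁} {L₁} {l₂} {L₂} v₁ v₂ = trans (sym (sum₁ d v₁)) (sum₂ d v₂)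
    where open CommonWindow l₁ L₁ l₂ L₂

  greedy-unique : ∀ {d e l₁ L₁ l₂ L₂} → IsGreedy d → IsGreedy e →
    VanishesOutside d l₁ (l₁ + + L₁) → VanishesOutside e l₂ (l₂ + + L₂) →
    digitSum d l₁ L₁ ≡ digitSum e l₂ L₂ → ∀ i → d i ≡ e i
  greedy-unique {d} {e} {l₁} {L₁} {l₂} {L₂} gd ge dv ev eq =
    greedy-unique-window gd ge w K (widen₁ dv) (widen₂ ev) (trans (sum₁ d dv) (trans eq (sym (sum₂ e ev))))
    where open CommonWindow l₁ L₁ l₂ L₂

  lookupℤ : List ℕ → ℤ → ℕ
  lookupℤ _        -[1+ _ ]    = 0
  lookupℤ []       (+ _)       = 0
  lookupℤ (b ∷ _)  (+ ℕ.zero)  = b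
  lookupℤ (_ ∷ bs) (+ ℕ.suc k) = lookupℤ bs (+ k)

  digitAt : ℤ → List ℕ → ℤ → ℕ
  digitAt m bs i = lookupℤ bs (i - m)

  digitAt-m+k : ∀ m bs k → digitAt m bs (m + + k) ≡ lookupℤ bs (+ k)
  digitAt-m+k m bs k = cong (lookupℤ bs) (lemma m (+ k))
    where
    lemma : ∀ m k → m + k - m ≡ k
    lemma = solve-∀

  digitAt-vanishesOutside : ∀ m bs → VanishesOutside (digitAt m bs) m (m + + length bs)
  digitAt-vanishesOutside m bs i (inj₁ i<m) with ℤP.i<j⇒suc[i]≤j i<m
  ... | 1+i≤m = subst (λ j → lookupℤ bs j ≡ 0) (sym i-m≡neg) refl
    where
    k = ℤ.∣ 1ℤ + i - m ∣
    i-m≡neg : i - m ≡ -[1+ k ]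
    i-m≡neg = begin
      i - m                         ≡⟨ cong (_-_ i) (i≤j⇒j≡i+∣i-j∣ 1+i≤m) ⟩
      i - (1ℤ + i + + k)             ≡⟨ lemma i (+ k) ⟩
      - (+ ℕ.suc k)                 ≡⟨⟩
      -[1+ k ]                      ∎
      where
      open ≡-Reasoning
      lemma : ∀ i k → i - (1ℤ + i + k) ≡ - (1ℤ + k)
      lemma = solve-∀
  digitAt-vanishesOutside m bs i (inj₂ top≤i) = trans (cong (digitAt m bs) (i≡)) (trans (digitAt-m+k m bs _) (beyond bs _))
    where
    i≡ : i ≡ m + + (length bs ℕ.+ ℤ.∣ m + + length bs - i ∣)
    i≡ = trans (i≤j⇒j≡i+∣i-j∣ top≤i) (trans (ℤP.+-assoc m (+ length bs) _) (cong (_+_ m) (sym (ℤP.pos-+ (length bs) _))))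
    beyond : ∀ bs j → lookupℤ bs (+ (length bs ℕ.+ j)) ≡ 0
    beyond []       ℕ.zero    = refl
    beyond []       (ℕ.suc j) = refl
    beyond (b ∷ bs) j         = beyond bs j

  evalDigits≡digitSum : ∀ m bs → evalDigits a m bs ≡ digitSum (digitAt m bs) m (length bs)
  evalDigits≡digitSum m []       = refl
  evalDigits≡digitSum m (b ∷ bs) = cong₂ _+θ_
    (cong (λ i → ⌜ lookupℤ (b ∷ bs) i ⌝ *θ ϑ^ m) (sym (ℤP.+-inverseʳ m)))
    (trans (evalDigits≡digitSum (m + 1ℤ) bs) (digitSum-cong _ _ (m + 1ℤ) (length bs) shifted))
    where
    shifted : ∀ k → k ℕ.< length bs → digitAt (m + 1ℤ) bs (m + 1ℤ + + k) ≡ digitAt m (b ∷ bs) (m + 1ℤ + + k)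
    shifted k _ = trans (digitAt-m+k (m + 1ℤ) bs k)
                        (sym (trans (cong (digitAt m (b ∷ bs)) (i+1+n≡i+[1+n] m k)) (digitAt-m+k m (b ∷ bs) (ℕ.suc k))))

  digitAt-greedy : ∀ m {bs} → GreedyDigits a bs → IsGreedy (digitAt m bs)
  digitAt-greedy m {bs} g = record
    { bounded    = λ i → bounded (i - m)
    ; admissible = λ i top → admissible (i - m) (subst (λ j → lookupℤ bs j ≡ a) (lemma i m) top) }
    where
    lemma : ∀ i m → i + 1ℤ - m ≡ i - m + 1ℤ
    lemma = solve-∀

    bounded : ∀ j → lookupℤ bs j ℕ.≤ a
    bounded = go g
      where
      go : ∀ {bs} → GreedyDigits a bs → ∀ j → lookupℤ bs j ℕ.≤ a
      go g             -[1+ _ ]    = ℕ.z≤n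
      go []            (+ _)       = ℕ.z≤n
      go [ b≤a ]       (+ ℕ.zero)  = b≤a
      go [ _ ]         (+ ℕ.suc _) = ℕ.z≤n
      go (_∷_ b≤a _ _) (+ ℕ.zero)  = b≤a
      go (_∷_ _ _ g)   (+ ℕ.suc k) = go g (+ k)

    -- Past the end of the list the next digit is 0, which equals a only if a = 0,
    -- and then every digit is 0 anyway.
    admissible : ∀ j → lookupℤ bs (j + 1ℤ) ≡ a → lookupℤ bs j ≡ 0
    admissible -[1+ _ ] _   = refl
    admissible (+ k)    top = go g k (subst (λ n → lookupℤ bs (+ n) ≡ a) (ℕP.+-comm k 1) top)
      where
      go : ∀ {bs} → GreedyDigits a bs → ∀ k → lookupℤ bs (+ ℕ.suc k) ≡ a → lookupℤ bs (+ k) ≡ 0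
      go []          _          _   = refl
      go [ b≤a ]     ℕ.zero     a≡0 = ℕP.n≤0⇒n≡0 (subst (_ ℕ.≤_) (sym a≡0) b≤a)
      go [ _ ]       (ℕ.suc _)  _   = refl
      go (_∷_ _ c _) ℕ.zero     top = c top
      go (_∷_ _ _ g) (ℕ.suc k)  top = go g k top

  digitsFrom : (ℤ → ℕ) → ℤ → ℕ → List ℕ
  digitsFrom d m ℕ.zero    = []
  digitsFrom d m (ℕ.suc n) = d m ∷ digitsFrom d (m + 1ℤ) n

  digitSum≡evalDigits : ∀ d m n → digitSum d m n ≡ evalDigits a m (digitsFrom d m n)
  digitSum≡evalDigits d m ℕ.zero    = refl
  digitSum≡evalDigits d m (ℕ.suc n) = cong (⌜ d m ⌝ *θ ϑ^ m +θ_) (digitSum≡evalDigits d (m + 1ℤ) n)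

  digitsFrom-greedy : ∀ {d} → IsGreedy d → ∀ m n → GreedyDigits a (digitsFrom d m n)
  digitsFrom-greedy g m ℕ.zero             = []
  digitsFrom-greedy g m (ℕ.suc ℕ.zero)     = [ IsGreedy.bounded g m ]
  digitsFrom-greedy g m (ℕ.suc (ℕ.suc n))  =
    _∷_ (IsGreedy.bounded g m) (IsGreedy.admissible g m) (digitsFrom-greedy g (m + 1ℤ) (ℕ.suc n))

  digitAt-digitsFrom : ∀ d m n k → k ℕ.< n → digitAt m (digitsFrom d m n) (m + + k) ≡ d (m + + k)
  digitAt-digitsFrom d m n k k<n = trans (digitAt-m+k m _ k) (go m n k k<n)
    where
    go : ∀ m n k → k ℕ.< n → lookupℤ (digitsFrom d m n) (+ k) ≡ d (m + + k)
    go m (ℕ.suc n) ℕ.zero    _             = cong d (sym (ℤP.+-identityʳ m))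
    go m (ℕ.suc n) (ℕ.suc k) (ℕ.s≤s k<n)  = trans (go (m + 1ℤ) n k k<n) (cong d (i+1+n≡i+[1+n] m k))

  digitAt-+-greedy : ∀ {m₁ bs m₂ cs} → GreedyDigits a bs → GreedyDigits a cs → m₁ + + length bs ℤ.< m₂ →
                     IsGreedy (λ j → digitAt m₁ bs j ℕ.+ digitAt m₂ cs j)
  digitAt-+-greedy {m₁} {bs} {m₂} {cs} gb gc t<m₂ = record { bounded = bounded ; admissible = admissible }
    where
    d₁ = digitAt m₁ bs
    d₂ = digitAt m₂ cs
    g₁ = digitAt-greedy m₁ gb
    g₂ = digitAt-greedy m₂ gc
    d₁-above : ∀ j → m₂ ℤ.≤ j + 1ℤ → d₁ j ≡ 0
    d₁-above j m₂≤j+1 = digitAt-vanishesOutside m₁ bs j (inj₂ (i<j+1⇒i≤j (ℤP.<-≤-trans t<m₂ m₂≤j+1)))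
    d₂-below : ∀ j → j ℤ.< m₂ → d₂ j ≡ 0
    d₂-below j j<m₂ = digitAt-vanishesOutside m₂ cs j (inj₁ j<m₂)

    bounded : ∀ j → d₁ j ℕ.+ d₂ j ℕ.≤ a
    bounded j with j ℤP.<? m₂
    ... | yes j<m₂ = subst (ℕ._≤ a) (sym (trans (cong (d₁ j ℕ.+_) (d₂-below j j<m₂)) (ℕP.+-identityʳ _)))
                           (IsGreedy.bounded g₁ j)
    ... | no  j≮m₂ = subst (ℕ._≤ a) (sym (cong (ℕ._+ d₂ j) (d₁-above j (ℤP.≤-trans (ℤP.≮⇒≥ j≮m₂) (ℤP.<⇒≤ (i<i+1 j)))))) (IsGreedy.bounded g₂ j)

    admissible : ∀ j → d₁ (j + 1ℤ) ℕ.+ d₂ (j + 1ℤ) ≡ a → d₁ j ℕ.+ d₂ j ≡ 0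
    admissible j top with (j + 1ℤ) ℤP.<? m₂
    ... | yes j+1<m₂ = cong₂ ℕ._+_ (IsGreedy.admissible g₁ j top₁) (d₂-below j (ℤP.<-trans (i<i+1 j) j+1<m₂))
      where
      top₁ : d₁ (j + 1ℤ) ≡ a
      top₁ = trans (sym (trans (cong (d₁ (j + 1ℤ) ℕ.+_) (d₂-below _ j+1<m₂)) (ℕP.+-identityʳ _))) top
    ... | no  j+1≮m₂ = cong₂ ℕ._+_ (d₁-above j m₂≤j+1) (IsGreedy.admissible g₂ j top₂)
      where
      m₂≤j+1 = ℤP.≮⇒≥ j+1≮m₂
      top₂ : d₂ (j + 1ℤ) ≡ a
      top₂ = trans (sym (cong (ℕ._+ d₂ (j + 1ℤ)) (d₁-above (j + 1ℤ) (ℤP.≤-trans m₂≤j+1 (ℤP.<⇒≤ (i<i+1 (j + 1ℤ))))))) top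

  greedy-unique-below : ∀ {l xs m₁ bs m₂ cs} → GreedyDigits a xs → GreedyDigits a bs → GreedyDigits a cs →
    m₁ + + length bs ℤ.< m₂ → evalDigits a l xs ≡ evalDigits a m₁ bs +θ evalDigits a m₂ cs →
    ∀ i → i ℤ.< m₂ → digitAt l xs i ≡ digitAt m₁ bs i
  greedy-unique-below {l} {xs} {m₁} {bs} {m₂} {cs} gx gb gc t<m₂ eq i i<m₂ = begin
    digitAt l xs i   ≡⟨ greedy-unique (digitAt-greedy l gx) (digitAt-+-greedy gb gc t<m₂)
                                      (digitAt-vanishesOutside l xs) sum-vanishes sums i ⟩
    d₁ i ℕ.+ d₂ i    ≡⟨ cong (d₁ i ℕ.+_) (digitAt-vanishesOutside m₂ cs i (inj₁ i<m₂)) ⟩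
    d₁ i ℕ.+ 0       ≡⟨ ℕP.+-identityʳ (d₁ i) ⟩
    d₁ i             ∎
    where
    open ≡-Reasoning
    d₁ = digitAt m₁ bs
    d₂ = digitAt m₂ cs
    t = m₁ + + length bs
    h = m₂ + + length cs
    t≤h = ℤP.≤-trans (ℤP.<⇒≤ t<m₂) (i≤i+n m₂ (length cs))
    m₁≤m₂ = ℤP.≤-trans (i≤i+n m₁ (length bs)) (ℤP.<⇒≤ t<m₂)
    m₁≤h = ℤP.≤-trans (i≤i+n m₁ (length bs)) t≤h
    K = ℤ.∣ m₁ - h ∣
    h≡m₁+K = i≤j⇒j≡i+∣i-j∣ m₁≤h

    sum-vanishes : VanishesOutside (λ j → d₁ j ℕ.+ d₂ j) m₁ (m₁ + + K)
    sum-vanishes j (inj₁ j<m₁)  = cong₂ ℕ._+_ (digitAt-vanishesOutside m₁ bs j (inj₁ j<m₁))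
                                              (digitAt-vanishesOutside m₂ cs j (inj₁ (ℤP.<-≤-trans j<m₁ m₁≤m₂)))
    sum-vanishes j (inj₂ top≤j) = cong₂ ℕ._+_ (digitAt-vanishesOutside m₁ bs j (inj₂ (ℤP.≤-trans t≤h h≤j)))
                                              (digitAt-vanishesOutside m₂ cs j (inj₂ h≤j))
      where
      h≤j = subst (ℤ._≤ j) (sym h≡m₁+K) top≤j

    sums : digitSum (digitAt l xs) l (length xs) ≡ digitSum (λ j → d₁ j ℕ.+ d₂ j) m₁ K
    sums = begin
      digitSum (digitAt l xs) l (length xs)                     ≡⟨ sym (evalDigits≡digitSum l xs) ⟩
      evalDigits a l xs                                         ≡⟨ eq ⟩
      evalDigits a m₁ bs +θ evalDigits a m₂ cs                  ≡⟨ cong₂ _+θ_ (evalDigits≡digitSum m₁ bs) (evalDigits≡digitSum m₂ cs) ⟩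
      digitSum d₁ m₁ (length bs) +θ digitSum d₂ m₂ (length cs)
        ≡⟨ sym (cong₂ _+θ_ (digitSum-window d₁ (digitAt-vanishesOutside m₁ bs) ℤP.≤-refl (subst (t ℤ.≤_) h≡m₁+K t≤h))
                           (digitSum-window d₂ (digitAt-vanishesOutside m₂ cs) m₁≤m₂ (ℤP.≤-reflexive h≡m₁+K))) ⟩
      digitSum d₁ m₁ K +θ digitSum d₂ m₁ K                      ≡⟨ sym (digitSum-+ d₁ d₂ m₁ K) ⟩
      digitSum (λ j → d₁ j ℕ.+ d₂ j) m₁ K                       ∎

  expansion⇒πEq : ∀ x α → IsGreedyExpansionOf a x α → πEq a x α
  expansion⇒πEq x α (N , vanish , partialN) _ = N , λ n N≤n → inj₁ (begin
    digitSum d l n -θ α                                    ≡⟨ cong (λ n → digitSum d l n -θ α) (sym (ℕP.m+[n∸m]≡n N≤n)) ⟩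
    digitSum d l (N ℕ.+ (n ℕ.∸ N)) -θ α                    ≡⟨ cong (_-θ α) (digitSum-split d l N (n ℕ.∸ N)) ⟩
    digitSum d l N +θ digitSum d (l + + N) (n ℕ.∸ N) -θ α  ≡⟨ cong₂ (λ s t → s +θ t -θ α) partialN
                                                               (digitSum-zero d (l + + N) (n ℕ.∸ N) (λ k _ → vanish _ (i≤i+n (l + + N) k))) ⟩
    α +θ 𝟘 -θ α                                           ≡⟨ solve 1 (λ x → x :+ con 0ℤ :- x := con 0ℤ) refl α ⟩
    𝟘                                                     ∎)
    where
    open ≡-Reasoning
    d = digit x
    l = low x

  series-greedy : (x : GreedySeries a) → IsGreedy (digit x)
  series-greedy x = record { bounded = digit≤a x ; admissible = greedy x }

  digit≡digitAt-digitsFrom : (x : GreedySeries a) → ∀ n i → i ℤ.< low x + + n →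
                             digit x i ≡ digitAt (low x) (digitsFrom (digit x) (low x) n) i
  digit≡digitAt-digitsFrom x n i i<top with i ℤP.<? low x
  ... | yes i<low = trans (below x i i<low) (sym (digitAt-vanishesOutside (low x) _ i (inj₁ i<low)))
  ... | no  i≮low = begin
    digit x i                                                     ≡⟨ cong (digit x) i≡ ⟩
    digit x (low x + + j)                                         ≡⟨ sym (digitAt-digitsFrom (digit x) (low x) n j j<n) ⟩
    digitAt (low x) (digitsFrom (digit x) (low x) n) (low x + + j) ≡⟨ cong (digitAt (low x) _) (sym i≡) ⟩
    digitAt (low x) (digitsFrom (digit x) (low x) n) i            ∎
    where
    open ≡-Reasoning
    j = ℤ.∣ low x - i ∣
    i≡ : i ≡ low x + + j
    i≡ = i≤j⇒j≡i+∣i-j∣ (ℤP.≮⇒≥ i≮low)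
    j<n : j ℕ.< n
    j<n = ℤP.drop‿+<+ (+-cancelˡ-< (low x) (subst (ℤ._< low x + + n) i≡ i<top))

  same-digits⇒expansion : ∀ {α m bs} → evalDigits a m bs ≡ α → (x : GreedySeries a) →
                          (∀ i → digit x i ≡ digitAt m bs i) → IsGreedyExpansionOf a x α
  same-digits⇒expansion {α} {m} {bs} value≡α x same = N , vanish-above , (begin
    digitSum (digit x) (low x) N       ≡⟨ digitSum-cong (digit x) (digitAt m bs) (low x) N (λ k _ → same (low x + + k)) ⟩
    digitSum (digitAt m bs) (low x) N  ≡⟨ digitSum-window-indep (digitAt m bs) vanish (digitAt-vanishesOutside m bs) ⟩
    digitSum (digitAt m bs) m (length bs) ≡⟨ sym (evalDigits≡digitSum m bs) ⟩
    evalDigits a m bs                  ≡⟨ value≡α ⟩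
    α                                  ∎)
    where
    open ≡-Reasoning
    t = m + + length bs
    N = ℤ.∣ low x - t ∣
    t≤top : t ℤ.≤ low x + + N
    t≤top = j≤i+∣i-j∣ (low x) t
    vanish : VanishesOutside (digitAt m bs) (low x) (low x + + N)
    vanish i (inj₁ i<low) = trans (sym (same i)) (below x i i<low)
    vanish i (inj₂ top≤i) = digitAt-vanishesOutside m bs i (inj₂ (ℤP.≤-trans t≤top top≤i))
    vanish-above : ∀ i → low x + + N ℤ.≤ i → digit x i ≡ 0
    vanish-above i top≤i = trans (same i) (vanish i (inj₂ top≤i))

-- Positive a (p , q) says u + v √D > 0 for u = 2p + aq, v = q and D = a² + 4; multiplication
-- by θ = (a + √D)/2 acts on (u , v) as (u , v) ↦ ((au + Dv)/2 , (u + av)/2) and negates the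
-- norm u² - D v².
module Positivity (a : ℕ) where

  open IntegerFacts
  open ZTheta a using (A)

  D : ℤ
  D = A * A + + 4

  PosUV : ℤ → ℤ → Set
  PosUV u v = (0ℤ ℤ.< u × v * v * D ℤ.< u * u)
            ⊎ (0ℤ ℤ.< v × u * u ℤ.< v * v * D)
            ⊎ (0ℤ ℤ.≤ u × 0ℤ ℤ.≤ v × 0ℤ ℤ.< u + v)

  private
    0≤A : 0ℤ ℤ.≤ A
    0≤A = 0≤+ a

    0<D : 0ℤ ℤ.< D
    0<D = subst (0ℤ ℤ.<_) (ℤP.+-comm (+ 4) (A * A)) (0<-+ (0<+suc 3) (0≤-square A))

  posUV-nonpositive : ∀ {u v} → PosUV u v → u ℤ.≤ 0ℤ → v ℤ.≤ 0ℤ → ⊥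
  posUV-nonpositive (inj₁ (0<u , _))               u≤0 _   = ℤP.<-irrefl refl (ℤP.<-≤-trans 0<u u≤0)
  posUV-nonpositive (inj₂ (inj₁ (0<v , _)))        _   v≤0 = ℤP.<-irrefl refl (ℤP.<-≤-trans 0<v v≤0)
  posUV-nonpositive (inj₂ (inj₂ (_ , _ , 0<u+v))) u≤0 v≤0 = ℤP.<-irrefl refl (ℤP.<-≤-trans 0<u+v (ℤP.+-mono-≤ u≤0 v≤0))

  -- In the next two lemmas, if the claim failed, every summand of key would be ≥ 0 and the
  -- first one > 0.
  posUV-u+Av : ∀ {u v} → PosUV u v → v ℤ.< 0ℤ → 0ℤ ℤ.< u + A * v
  posUV-u+Av {u} {v} (inj₁ (0<u , norm>0)) v<0 with 0ℤ ℤP.<? u + A * v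
  ... | yes 0<u+Av = 0<u+Av
  ... | no  0≮u+Av = ⊥-elim (0<-+≢0 (<⇒0<- norm>0)
          (0≤-+ (0≤-* (ℤP.<⇒≤ (0<-+ 0<u (0≤-* 0≤A (ℤP.<⇒≤ (0<-neg v<0))))) (0≤-neg (ℤP.≮⇒≥ 0≮u+Av))) (0≤-* (0≤+ 4) (0≤-square v)))
          (key A u v))
    where
    key : ∀ A u v → (u * u - v * v * (A * A + + 4)) + ((u + A * - v) * - (u + A * v) + + 4 * (v * v)) ≡ 0ℤ
    key = solve-∀
  posUV-u+Av (inj₂ (inj₁ (0<v , _)))        v<0 = ⊥-elim (ℤP.<-asym 0<v v<0)
  posUV-u+Av (inj₂ (inj₂ (_ , 0≤v , _)))    v<0 = ⊥-elim (ℤP.<-irrefl refl (ℤP.<-≤-trans v<0 0≤v))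

  posUV-Au+Dv : ∀ {u v} → PosUV u v → u ℤ.< 0ℤ → 0ℤ ℤ.< A * u + D * v
  posUV-Au+Dv (inj₁ (0<u , _))              u<0 = ⊥-elim (ℤP.<-asym 0<u u<0)
  posUV-Au+Dv {u} {v} (inj₂ (inj₁ (0<v , norm<0))) u<0 with 0ℤ ℤP.<? A * u + D * v
  ... | yes 0<Au+Dv = 0<Au+Dv
  ... | no  0≮Au+Dv = ⊥-elim (0<-+≢0 (0<-* 0<D (<⇒0<- norm<0))
          (0≤-+ (0≤-* (0≤-neg (ℤP.≮⇒≥ 0≮Au+Dv)) (ℤP.<⇒≤ (0<-+ (0<-* 0<D 0<v) (0≤-* (0≤+ a) (ℤP.<⇒≤ (0<-neg u<0)))))) (0≤-* (0≤+ 4) (0≤-square u)))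
          (key A u v))
    where
    key : ∀ A u v → (A * A + + 4) * (v * v * (A * A + + 4) - u * u)
                    + (- (A * u + (A * A + + 4) * v) * ((A * A + + 4) * v + A * - u) + + 4 * (u * u)) ≡ 0ℤ
    key = solve-∀
  posUV-Au+Dv (inj₂ (inj₂ (0≤u , _ , _)))  u<0 = ⊥-elim (ℤP.<-irrefl refl (ℤP.<-≤-trans u<0 0≤u))

  private
    module Step {u v u′ v′ : ℤ} (2u′ : + 2 * u′ ≡ A * u + D * v) (2v′ : + 2 * v′ ≡ u + A * v)
                (norm′ : u′ * u′ - v′ * v′ * D ≡ - (u * u - v * v * D)) where

      from-nonneg : 0ℤ ℤ.≤ u → 0ℤ ℤ.≤ v → 0ℤ ℤ.< u + v → PosUV u′ v′
      from-nonneg 0≤u 0≤v 0<u+v = inj₂ (inj₂ (0≤u′ , 0≤v′ , 0<u′+v′))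
        where
        0≤u′ = 0≤-half u′ (subst (0ℤ ℤ.≤_) (sym 2u′) (0≤-+ (0≤-* 0≤A 0≤u) (0≤-* (ℤP.<⇒≤ 0<D) 0≤v)))
        0≤v′ = 0≤-half v′ (subst (0ℤ ℤ.≤_) (sym 2v′) (0≤-+ 0≤u (0≤-* 0≤A 0≤v)))
        sum : + 2 * (u′ + v′) ≡ u + v + (A * u + (A * A + A + + 3) * v)
        sum = begin
          + 2 * (u′ + v′)                          ≡⟨ ℤP.*-distribˡ-+ (+ 2) u′ v′ ⟩
          + 2 * u′ + + 2 * v′                      ≡⟨ cong₂ _+_ 2u′ 2v′ ⟩
          A * u + D * v + (u + A * v)              ≡⟨ lemma A u v ⟩
          u + v + (A * u + (A * A + A + + 3) * v)  ∎
          where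
          open ≡-Reasoning
          lemma : ∀ A u v → A * u + (A * A + + 4) * v + (u + A * v) ≡ u + v + (A * u + (A * A + A + + 3) * v)
          lemma = solve-∀
        0<u′+v′ = 0<-half (u′ + v′) (subst (0ℤ ℤ.<_) (sym sum)
          (0<-+ 0<u+v (0≤-+ (0≤-* 0≤A 0≤u) (0≤-* (0≤-+ (0≤-+ (0≤-square A) 0≤A) (0≤+ 3)) 0≤v))))

      norm-negated : v′ * v′ * D - u′ * u′ ≡ u * u - v * v * D
      norm-negated = trans (lemma u′ v′ D) (trans (cong -_ norm′) (ℤP.neg-involutive _))
        where
        lemma : ∀ u v D → v * v * D - u * u ≡ - (u * u - v * v * D)
        lemma = solve-∀

      norm-negated′ : u′ * u′ - v′ * v′ * D ≡ v * v * D - u * u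
      norm-negated′ = trans norm′ (lemma u v D)
        where
        lemma : ∀ u v D → - (u * u - v * v * D) ≡ v * v * D - u * u
        lemma = solve-∀

  posUV-step : ∀ {u v u′ v′} → + 2 * u′ ≡ A * u + D * v → + 2 * v′ ≡ u + A * v →
               u′ * u′ - v′ * v′ * D ≡ - (u * u - v * v * D) → PosUV u v → PosUV u′ v′
  posUV-step {u} {v} {u′} {v′} 2u′ 2v′ norm′ pos = cases pos
    where
    open Step 2u′ 2v′ norm′
    cases : PosUV u v → PosUV u′ v′
    cases (inj₂ (inj₂ (0≤u , 0≤v , 0<u+v))) = from-nonneg 0≤u 0≤v 0<u+v
    cases (inj₁ (0<u , norm>0)) with 0ℤ ℤP.≤? v
    ... | yes 0≤v = from-nonneg (ℤP.<⇒≤ 0<u) 0≤v (0<-+ 0<u 0≤v)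
    ... | no  0≰v with 0ℤ ℤP.≤? u′
    ...   | yes 0≤u′ = inj₂ (inj₂ (0≤u′ , ℤP.<⇒≤ 0<v′ , subst (0ℤ ℤ.<_) (ℤP.+-comm v′ u′) (0<-+ 0<v′ 0≤u′)))
      where
      0<v′ = 0<-half v′ (subst (0ℤ ℤ.<_) (sym 2v′) (posUV-u+Av pos (ℤP.≰⇒> 0≰v)))
    ...   | no  0≰u′ = inj₂ (inj₁ (0<v′ , 0<-⇒< (subst (0ℤ ℤ.<_) (sym norm-negated) (<⇒0<- norm>0))))
      where
      0<v′ = 0<-half v′ (subst (0ℤ ℤ.<_) (sym 2v′) (posUV-u+Av pos (ℤP.≰⇒> 0≰v)))
    cases (inj₂ (inj₁ (0<v , norm<0))) with 0ℤ ℤP.≤? u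
    ... | yes 0≤u = from-nonneg 0≤u (ℤP.<⇒≤ 0<v) (subst (0ℤ ℤ.<_) (ℤP.+-comm v u) (0<-+ 0<v 0≤u))
    ... | no  0≰u with 0ℤ ℤP.≤? v′
    ...   | yes 0≤v′ = inj₂ (inj₂ (ℤP.<⇒≤ 0<u′ , 0≤v′ , 0<-+ 0<u′ 0≤v′))
      where
      0<u′ = 0<-half u′ (subst (0ℤ ℤ.<_) (sym 2u′) (posUV-Au+Dv pos (ℤP.≰⇒> 0≰u)))
    ...   | no  0≰v′ = inj₁ (0<u′ , 0<-⇒< (subst (0ℤ ℤ.<_) (sym norm-negated′) (<⇒0<- norm<0)))
      where
      0<u′ = 0<-half u′ (subst (0ℤ ℤ.<_) (sym 2u′) (posUV-Au+Dv pos (ℤP.≰⇒> 0≰u)))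

  positive-*θ : ∀ {p q} → Positive a (p , q) → Positive a (q , p + A * q)
  positive-*θ {p} {q} = posUV-step (first A p q) (second A p q) (third A p q)
    where
    first : ∀ A p q → + 2 * (+ 2 * q + A * (p + A * q)) ≡ A * (+ 2 * p + A * q) + (A * A + + 4) * q
    first = solve-∀
    second : ∀ A p q → + 2 * (p + A * q) ≡ + 2 * p + A * q + A * q
    second = solve-∀
    third : ∀ A p q →
      (+ 2 * q + A * (p + A * q)) * (+ 2 * q + A * (p + A * q)) - (p + A * q) * (p + A * q) * (A * A + + 4)
      ≡ - ((+ 2 * p + A * q) * (+ 2 * p + A * q) - q * q * (A * A + + 4))
    third = solve-∀

  positive-q<0 : ∀ {p q} → Positive a (p , q) → q ℤ.< 0ℤ → 0ℤ ℤ.< p + A * q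
  positive-q<0 {p} {q} pos q<0 = 0<-half (p + A * q) (subst (0ℤ ℤ.<_) (lemma A p q) (posUV-u+Av pos q<0))
    where
    lemma : ∀ A p q → + 2 * p + A * q + A * q ≡ + 2 * (p + A * q)
    lemma = solve-∀

  positive-nonpositive : ∀ {p q} → Positive a (p , q) → p ℤ.≤ 0ℤ → q ℤ.≤ 0ℤ → ⊥
  positive-nonpositive {p} {q} pos p≤0 q≤0 = posUV-nonpositive pos u≤0 q≤0
    where
    u≤0 : + 2 * p + A * q ℤ.≤ 0ℤ
    u≤0 = ℤP.neg-cancel-≤ (subst (0ℤ ℤ.≤_) (lemma A p q) (0≤-+ (0≤-* (0≤+ 2) (0≤-neg p≤0)) (0≤-* (0≤+ a) (0≤-neg q≤0))))
      where
      lemma : ∀ A p q → + 2 * - p + A * - q ≡ - (+ 2 * p + A * q)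
      lemma = solve-∀

module Existence (a′ : ℕ) where

  a : ℕ
  a = ℕ.suc a′

  open ZTheta a
  open Solver using (solve; _:+_; _:*_; _:-_; :-_; _:=_; con)

  HasGreedyExpansion : ℤθ → Set
  HasGreedyExpansion x = ∃[ m ] ∃[ bs ] GreedyDigits a bs × evalDigits a m bs ≡ x

  private
    relation₁ : ϑ *θ ϑ⁻¹ -θ 𝟙 ≡ 𝟘
    relation₁ = trans (cong (_-θ 𝟙) ϑ*ϑ⁻¹) (negθ-inverseʳ 𝟙)

    relation₂ : ϑ -θ (𝟙 +θ ⌜ a′ ⌝ +θ ϑ⁻¹) ≡ 𝟘
    relation₂ = trans (cong (λ t → t -θ (𝟙 +θ ⌜ a′ ⌝ +θ ϑ⁻¹)) (trans ϑ≡a+ϑ⁻¹ (cong (_+θ ϑ⁻¹) (⌜suc⌝ a′))))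
                      (negθ-inverseʳ (𝟙 +θ ⌜ a′ ⌝ +θ ϑ⁻¹))

  -- Identities between digit values follow from θ θ⁻¹ = 1 and θ = a + θ⁻¹ (and possibly one
  -- further hypothesis u ≡ v): the solver checks that x - y is the stated combination of them.
  by-relations : ∀ {x y} k l → x -θ y ≡ k *θ (ϑ *θ ϑ⁻¹ -θ 𝟙) +θ l *θ (ϑ -θ (𝟙 +θ ⌜ a′ ⌝ +θ ϑ⁻¹)) → x ≡ y
  by-relations {x} {y} k l eq = begin
    x                                                        ≡⟨ solve 2 (λ x y → x := x :- y :+ y) refl x y ⟩
    x -θ y +θ y                                              ≡⟨ cong (_+θ y) eq ⟩
    k *θ (ϑ *θ ϑ⁻¹ -θ 𝟙) +θ l *θ (ϑ -θ (𝟙 +θ ⌜ a′ ⌝ +θ ϑ⁻¹)) +θ y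
                                                             ≡⟨ cong₂ (λ r₁ r₂ → k *θ r₁ +θ l *θ r₂ +θ y) relation₁ relation₂ ⟩
    k *θ 𝟘 +θ l *θ 𝟘 +θ y                                    ≡⟨ solve 3 (λ k l y → k :* con 0ℤ :+ l :* con 0ℤ :+ y := y) refl k l y ⟩
    y                                                        ∎
    where open ≡-Reasoning

  by-relations′ : ∀ {x y u v} k l m → u ≡ v →
    x -θ y ≡ k *θ (ϑ *θ ϑ⁻¹ -θ 𝟙) +θ l *θ (ϑ -θ (𝟙 +θ ⌜ a′ ⌝ +θ ϑ⁻¹)) +θ m *θ (u -θ v) → x ≡ y
  by-relations′ {u = u} k l m refl eq = by-relations k l (trans eq (trans
    (cong (λ r → k *θ (ϑ *θ ϑ⁻¹ -θ 𝟙) +θ l *θ (ϑ -θ (𝟙 +θ ⌜ a′ ⌝ +θ ϑ⁻¹)) +θ m *θ r) (negθ-inverseʳ u))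
    (solve 2 (λ r m → r :+ m :* con 0ℤ := r) refl (k *θ (ϑ *θ ϑ⁻¹ -θ 𝟙) +θ l *θ (ϑ -θ (𝟙 +θ ⌜ a′ ⌝ +θ ϑ⁻¹))) m)))

  -- A greedy expansion split at a cursor: the digits below it listed downwards from
  -- position -1, the digits from position 0 upwards.
  data GreedyDown : List ℕ → Set where
    []     : GreedyDown []
    [_]    : ∀ {e} → e ℕ.≤ a → GreedyDown (e ∷ [])
    _∷⟨_⟩_ : ∀ {e f r} → e ℕ.≤ a → (e ≡ a → f ≡ 0) → GreedyDown (f ∷ r) → GreedyDown (e ∷ f ∷ r)

  head₀ : List ℕ → ℕ
  head₀ []      = 0
  head₀ (b ∷ _) = b

  Junction : List ℕ → List ℕ → Set
  Junction lower upper = head₀ upper ≡ a → head₀ lower ≡ 0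

  lowerValue : List ℕ → ℤθ
  lowerValue []      = 𝟘
  lowerValue (e ∷ L) = ϑ⁻¹ *θ (⌜ e ⌝ +θ lowerValue L)

  upperValue : List ℕ → ℤθ
  upperValue []      = 𝟘
  upperValue (d ∷ U) = ⌜ d ⌝ +θ ϑ *θ upperValue U

  record Zipper : Set where
    constructor zipper
    field
      {lower upper} : List ℕ
      lower-greedy  : GreedyDown lower
      upper-greedy  : GreedyDigits a upper
      junction      : Junction lower upper

  value : Zipper → ℤθ
  value z = lowerValue (Zipper.lower z) +θ upperValue (Zipper.upper z)

  private
    0≢a : 0 ≢ a
    0≢a ()

    n≢n+1 : ∀ {n} → n ≢ ℕ.suc n
    n≢n+1 ()

  greedyDown-∷ : ∀ {e L} → e ℕ.≤ a → (e ≡ a → head₀ L ≡ 0) → GreedyDown L → GreedyDown (e ∷ L)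
  greedyDown-∷ e≤a _    []              = [ e≤a ]
  greedyDown-∷ e≤a e=a⇒ g@([ _ ])       = e≤a ∷⟨ e=a⇒ ⟩ g
  greedyDown-∷ e≤a e=a⇒ g@(_ ∷⟨ _ ⟩ _)  = e≤a ∷⟨ e=a⇒ ⟩ g

  greedyDown-uncons : ∀ {e L} → GreedyDown (e ∷ L) → e ℕ.≤ a × (e ≡ a → head₀ L ≡ 0) × GreedyDown L
  greedyDown-uncons [ e≤a ]            = e≤a , (λ _ → refl) , []
  greedyDown-uncons (e≤a ∷⟨ e=a⇒ ⟩ g) = e≤a , e=a⇒ , g

  greedyDigits-∷ : ∀ {b U} → b ℕ.≤ a → (head₀ U ≡ a → b ≡ 0) → GreedyDigits a U → GreedyDigits a (b ∷ U)
  greedyDigits-∷ b≤a _      []                 = [ b≤a ]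
  greedyDigits-∷ b≤a next=a⇒ g@([ _ ])         = _∷_ b≤a next=a⇒ g
  greedyDigits-∷ b≤a next=a⇒ g@(_∷_ _ _ _)     = _∷_ b≤a next=a⇒ g

  greedyDigits-uncons : ∀ {b U} → GreedyDigits a (b ∷ U) → b ℕ.≤ a × (head₀ U ≡ a → b ≡ 0) × GreedyDigits a U
  greedyDigits-uncons [ b≤a ]              = b≤a , (λ 0=a → ⊥-elim (0≢a 0=a)) , []
  greedyDigits-uncons (_∷_ b≤a next=a⇒ g) = b≤a , next=a⇒ , g

  greedyDown-0∷ : ∀ {L} → GreedyDown L → GreedyDown (0 ∷ L)
  greedyDown-0∷ = greedyDown-∷ ℕ.z≤n (λ 0=a → ⊥-elim (0≢a 0=a))

  shift-value : ∀ e L U → lowerValue L +θ upperValue (e ∷ U) ≡ ϑ *θ (lowerValue (e ∷ L) +θ upperValue U)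
  shift-value e L U = by-relations (negθ (⌜ e ⌝ +θ lowerValue L)) 𝟘
    (solve 6 (λ t s c x h u → h :+ (x :+ t :* u) :- t :* (s :* (x :+ h) :+ u)
                              := (:- (x :+ h)) :* (t :* s :- con 1ℤ) :+ con 0ℤ :* (t :- (con 1ℤ :+ c :+ s)))
           refl ϑ ϑ⁻¹ ⌜ a′ ⌝ ⌜ e ⌝ (lowerValue L) (upperValue U))

  cursor-down : (z : Zipper) → Σ Zipper λ z′ → value z′ ≡ ϑ *θ value z
  cursor-down (zipper {[]} {U} gl gu _) =
    zipper gl (greedyDigits-∷ ℕ.z≤n (λ _ → refl) gu) (λ 0=a → ⊥-elim (0≢a 0=a)) ,
    solve 2 (λ t u → con 0ℤ :+ (con 0ℤ :+ t :* u) := t :* (con 0ℤ :+ u)) refl ϑ (upperValue U)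
  cursor-down (zipper {e ∷ L} {U} gl gu jn) with greedyDown-uncons gl
  ... | e≤a , e=a⇒ , gL = zipper gL (greedyDigits-∷ e≤a jn gu) e=a⇒ , shift-value e L U

  cursor-up : (z : Zipper) → Σ Zipper λ z′ → ϑ *θ value z′ ≡ value z
  cursor-up (zipper {L} {[]} gl gu jn) =
    zipper (greedyDown-0∷ gl) [] (λ _ → refl) ,
    by-relations (lowerValue L) 𝟘
      (solve 4 (λ t s c h → t :* (s :* (con 0ℤ :+ h) :+ con 0ℤ) :- (h :+ con 0ℤ)
                            := h :* (t :* s :- con 1ℤ) :+ con 0ℤ :* (t :- (con 1ℤ :+ c :+ s)))
             refl ϑ ϑ⁻¹ ⌜ a′ ⌝ (lowerValue L))
  cursor-up (zipper {L} {d ∷ U} gl gu jn) with greedyDigits-uncons gu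
  ... | d≤a , next=a⇒ , gU =
    zipper (greedyDown-∷ d≤a jn gl) gU next=a⇒ ,
    by-relations (⌜ d ⌝ +θ lowerValue L) 𝟘
      (solve 6 (λ t s c x h u → t :* (s :* (x :+ h) :+ u) :- (h :+ (x :+ t :* u))
                                := (x :+ h) :* (t :* s :- con 1ℤ) :+ con 0ℤ :* (t :- (con 1ℤ :+ c :+ s)))
             refl ϑ ϑ⁻¹ ⌜ a′ ⌝ ⌜ d ⌝ (lowerValue L) (upperValue U))

  raise-lower : ∀ d D → lowerValue (d ∷ D) +θ ϑ⁻¹ ≡ lowerValue (ℕ.suc d ∷ D) +θ ⌜ 0 ⌝
  raise-lower d D = begin
    ϑ⁻¹ *θ (⌜ d ⌝ +θ h) +θ ϑ⁻¹       ≡⟨ solve 3 (λ s x h → s :* (x :+ h) :+ s := s :* (con 1ℤ :+ x :+ h) :+ con 0ℤ) refl ϑ⁻¹ ⌜ d ⌝ h ⟩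
    ϑ⁻¹ *θ (𝟙 +θ ⌜ d ⌝ +θ h) +θ 𝟘     ≡⟨ cong (λ x → ϑ⁻¹ *θ (x +θ h) +θ 𝟘) (sym (⌜suc⌝ d)) ⟩
    ϑ⁻¹ *θ (⌜ ℕ.suc d ⌝ +θ h) +θ 𝟘    ∎
    where
    open ≡-Reasoning
    h = lowerValue D

  raise-upper : ∀ L d U → lowerValue L +θ upperValue (ℕ.suc d ∷ U) ≡ lowerValue L +θ upperValue (d ∷ U) +θ 𝟙
  raise-upper L d U = begin
    h +θ (⌜ ℕ.suc d ⌝ +θ ϑ *θ u)       ≡⟨ cong (λ x → h +θ (x +θ ϑ *θ u)) (⌜suc⌝ d) ⟩
    h +θ (𝟙 +θ ⌜ d ⌝ +θ ϑ *θ u)        ≡⟨ solve 4 (λ h x t u → h :+ (con 1ℤ :+ x :+ t :* u) := h :+ (x :+ t :* u) :+ con 1ℤ) refl h ⌜ d ⌝ ϑ u ⟩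
    h +θ (⌜ d ⌝ +θ ϑ *θ u) +θ 𝟙        ∎
    where
    open ≡-Reasoning
    h = lowerValue L
    u = upperValue U

  -- a θ⁻¹ + θ⁻² = 1
  lower-carry-rule : ∀ e r → lowerValue (a′ ∷ ℕ.suc e ∷ r) +θ ϑ⁻¹ ≡ lowerValue (0 ∷ e ∷ r) +θ ⌜ 1 ⌝
  lower-carry-rule e r = begin
    ϑ⁻¹ *θ (⌜ a′ ⌝ +θ ϑ⁻¹ *θ (⌜ ℕ.suc e ⌝ +θ h)) +θ ϑ⁻¹  ≡⟨ cong (λ x → ϑ⁻¹ *θ (⌜ a′ ⌝ +θ ϑ⁻¹ *θ (x +θ h)) +θ ϑ⁻¹) (⌜suc⌝ e) ⟩
    ϑ⁻¹ *θ (⌜ a′ ⌝ +θ ϑ⁻¹ *θ (𝟙 +θ ⌜ e ⌝ +θ h)) +θ ϑ⁻¹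
      ≡⟨ by-relations 𝟙 (negθ ϑ⁻¹)
           (solve 5 (λ t s c x h → s :* (c :+ s :* (con 1ℤ :+ x :+ h)) :+ s :- (s :* (con 0ℤ :+ s :* (x :+ h)) :+ con 1ℤ)
                                   := con 1ℤ :* (t :* s :- con 1ℤ) :+ (:- s) :* (t :- (con 1ℤ :+ c :+ s)))
                  refl ϑ ϑ⁻¹ ⌜ a′ ⌝ ⌜ e ⌝ h) ⟩
    ϑ⁻¹ *θ (𝟘 +θ ϑ⁻¹ *θ (⌜ e ⌝ +θ h)) +θ 𝟙                ∎
    where
    open ≡-Reasoning
    h = lowerValue r

  -- (a + 1) θ⁻¹ = 1 + (a - 1) θ⁻² + θ⁻³
  lower-overflow-rule : ∀ {r r′ c} → lowerValue r +θ ϑ⁻¹ ≡ lowerValue r′ +θ ⌜ c ⌝ →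
                        lowerValue (a ∷ 0 ∷ r) +θ ϑ⁻¹ ≡ lowerValue (0 ∷ a′ ℕ.+ c ∷ r′) +θ ⌜ 1 ⌝
  lower-overflow-rule {r} {r′} {c} carried = begin
    ϑ⁻¹ *θ (⌜ a ⌝ +θ ϑ⁻¹ *θ (𝟘 +θ h)) +θ ϑ⁻¹                    ≡⟨ cong (λ x → ϑ⁻¹ *θ (x +θ ϑ⁻¹ *θ (𝟘 +θ h)) +θ ϑ⁻¹) (⌜suc⌝ a′) ⟩
    ϑ⁻¹ *θ (𝟙 +θ ⌜ a′ ⌝ +θ ϑ⁻¹ *θ (𝟘 +θ h)) +θ ϑ⁻¹
      ≡⟨ by-relations′ (𝟙 -θ ϑ⁻¹) (ϑ⁻¹ *θ ϑ⁻¹ -θ ϑ⁻¹) (ϑ⁻¹ *θ ϑ⁻¹) carried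
           (solve 6 (λ t s c h x C → s :* (con 1ℤ :+ c :+ s :* (con 0ℤ :+ h)) :+ s :- (s :* (con 0ℤ :+ s :* (c :+ C :+ x)) :+ con 1ℤ)
                                     := (con 1ℤ :- s) :* (t :* s :- con 1ℤ) :+ (s :* s :- s) :* (t :- (con 1ℤ :+ c :+ s))
                                        :+ s :* s :* (h :+ s :- (x :+ C)))
                  refl ϑ ϑ⁻¹ ⌜ a′ ⌝ h h′ ⌜ c ⌝) ⟩
    ϑ⁻¹ *θ (𝟘 +θ ϑ⁻¹ *θ (⌜ a′ ⌝ +θ ⌜ c ⌝ +θ h′)) +θ 𝟙          ≡⟨ cong (λ x → ϑ⁻¹ *θ (𝟘 +θ ϑ⁻¹ *θ (x +θ h′)) +θ 𝟙) (sym (⌜+⌝ a′ c)) ⟩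
    ϑ⁻¹ *θ (𝟘 +θ ϑ⁻¹ *θ (⌜ a′ ℕ.+ c ⌝ +θ h′)) +θ 𝟙             ∎
    where
    open ≡-Reasoning
    h = lowerValue r
    h′ = lowerValue r′

  -- a + θ⁻¹ = θ
  carry-rule : ∀ e L U → ϑ *θ (lowerValue (0 ∷ e ∷ L) +θ upperValue U +θ 𝟙) ≡
                         lowerValue (ℕ.suc e ∷ L) +θ upperValue (a′ ∷ U) +θ 𝟙
  carry-rule e L U = begin
    ϑ *θ (ϑ⁻¹ *θ (𝟘 +θ ϑ⁻¹ *θ (⌜ e ⌝ +θ h)) +θ u +θ 𝟙)
      ≡⟨ by-relations (ϑ⁻¹ *θ (⌜ e ⌝ +θ h)) 𝟙
           (solve 6 (λ t s c x h u → t :* (s :* (con 0ℤ :+ s :* (x :+ h)) :+ u :+ con 1ℤ) :- (s :* (con 1ℤ :+ x :+ h) :+ (c :+ t :* u) :+ con 1ℤ)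
                                     := s :* (x :+ h) :* (t :* s :- con 1ℤ) :+ con 1ℤ :* (t :- (con 1ℤ :+ c :+ s)))
                  refl ϑ ϑ⁻¹ ⌜ a′ ⌝ ⌜ e ⌝ h u) ⟩
    ϑ⁻¹ *θ (𝟙 +θ ⌜ e ⌝ +θ h) +θ (⌜ a′ ⌝ +θ ϑ *θ u) +θ 𝟙      ≡⟨ cong (λ x → ϑ⁻¹ *θ (x +θ h) +θ (⌜ a′ ⌝ +θ ϑ *θ u) +θ 𝟙) (sym (⌜suc⌝ e)) ⟩
    ϑ⁻¹ *θ (⌜ ℕ.suc e ⌝ +θ h) +θ (⌜ a′ ⌝ +θ ϑ *θ u) +θ 𝟙     ∎
    where
    open ≡-Reasoning
    h = lowerValue L
    u = upperValue U

  -- a + 1 = θ + (a - 1) θ⁻¹ + θ⁻²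
  overflow-rule : ∀ {L L′ c} → lowerValue L +θ ϑ⁻¹ ≡ lowerValue L′ +θ ⌜ c ⌝ → ∀ U →
                  ϑ *θ (lowerValue (0 ∷ a′ ℕ.+ c ∷ L′) +θ upperValue U +θ 𝟙) ≡ lowerValue (0 ∷ L) +θ upperValue (a ∷ U) +θ 𝟙
  overflow-rule {L} {L′} {c} carried U = begin
    ϑ *θ (ϑ⁻¹ *θ (𝟘 +θ ϑ⁻¹ *θ (⌜ a′ ℕ.+ c ⌝ +θ h′)) +θ u +θ 𝟙)  ≡⟨ cong (λ x → ϑ *θ (ϑ⁻¹ *θ (𝟘 +θ ϑ⁻¹ *θ (x +θ h′)) +θ u +θ 𝟙)) (⌜+⌝ a′ c) ⟩
    ϑ *θ (ϑ⁻¹ *θ (𝟘 +θ ϑ⁻¹ *θ (⌜ a′ ⌝ +θ ⌜ c ⌝ +θ h′)) +θ u +θ 𝟙)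
      ≡⟨ by-relations′ (𝟙 +θ ϑ⁻¹ *θ h +θ ϑ⁻¹ *θ ⌜ a′ ⌝ +θ ϑ⁻¹ *θ ϑ⁻¹) (𝟙 -θ ϑ⁻¹) (negθ (ϑ *θ ϑ⁻¹ *θ ϑ⁻¹)) carried
           (solve 7 (λ t s c C h x u → t :* (s :* (con 0ℤ :+ s :* (c :+ C :+ x)) :+ u :+ con 1ℤ) :- (s :* (con 0ℤ :+ h) :+ (con 1ℤ :+ c :+ t :* u) :+ con 1ℤ)
                                       := (con 1ℤ :+ s :* h :+ s :* c :+ s :* s) :* (t :* s :- con 1ℤ) :+ (con 1ℤ :- s) :* (t :- (con 1ℤ :+ c :+ s))
                                          :+ (:- (t :* s :* s)) :* (h :+ s :- (x :+ C)))
                  refl ϑ ϑ⁻¹ ⌜ a′ ⌝ ⌜ c ⌝ h h′ u) ⟩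
    ϑ⁻¹ *θ (𝟘 +θ h) +θ (𝟙 +θ ⌜ a′ ⌝ +θ ϑ *θ u) +θ 𝟙             ≡⟨ cong (λ x → ϑ⁻¹ *θ (𝟘 +θ h) +θ (x +θ ϑ *θ u) +θ 𝟙) (sym (⌜suc⌝ a′)) ⟩
    ϑ⁻¹ *θ (𝟘 +θ h) +θ (⌜ a ⌝ +θ ϑ *θ u) +θ 𝟙                    ∎
    where
    open ≡-Reasoning
    h = lowerValue L
    h′ = lowerValue L′
    u = upperValue U

  -- 1 + a θ = θ²
  double-carry-rule : ∀ L U → ϑ *θ (ϑ *θ (lowerValue (0 ∷ 0 ∷ L) +θ upperValue U +θ 𝟙)) ≡
                              lowerValue L +θ upperValue (0 ∷ a ∷ U) +θ 𝟙
  double-carry-rule L U = begin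
    ϑ *θ (ϑ *θ (ϑ⁻¹ *θ (𝟘 +θ ϑ⁻¹ *θ (𝟘 +θ h)) +θ u +θ 𝟙))
      ≡⟨ by-relations ((ϑ *θ ϑ⁻¹ +θ 𝟙) *θ h +θ 𝟙) ϑ
           (solve 5 (λ t s c h u → t :* (t :* (s :* (con 0ℤ :+ s :* (con 0ℤ :+ h)) :+ u :+ con 1ℤ)) :- (h :+ (con 0ℤ :+ t :* (con 1ℤ :+ c :+ t :* u)) :+ con 1ℤ)
                                   := ((t :* s :+ con 1ℤ) :* h :+ con 1ℤ) :* (t :* s :- con 1ℤ) :+ t :* (t :- (con 1ℤ :+ c :+ s)))
                  refl ϑ ϑ⁻¹ ⌜ a′ ⌝ h u) ⟩
    h +θ (𝟘 +θ ϑ *θ (𝟙 +θ ⌜ a′ ⌝ +θ ϑ *θ u)) +θ 𝟙          ≡⟨ cong (λ x → h +θ (𝟘 +θ ϑ *θ (x +θ ϑ *θ u)) +θ 𝟙) (sym (⌜suc⌝ a′)) ⟩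
    h +θ (𝟘 +θ ϑ *θ (⌜ a ⌝ +θ ϑ *θ u)) +θ 𝟙                 ∎
    where
    open ≡-Reasoning
    h = lowerValue L
    u = upperValue U

  -- Adding θ⁻¹ below a cursor: new digits below plus a carry c into position 0. The field
  -- greedy says that a - 1 + c may be written at position -1 on top of the new digits.
  record Carry (D : List ℕ) : Set where
    constructor carry
    field
      {D′}    : List ℕ
      c       : ℕ
      greedy  : GreedyDown (a′ ℕ.+ c ∷ D′)
      carried : lowerValue D +θ ϑ⁻¹ ≡ lowerValue D′ +θ ⌜ c ⌝

  private
    no-carry : ∀ {D} → GreedyDown D → GreedyDown (a′ ℕ.+ 0 ∷ D)
    no-carry = greedyDown-∷ (ℕP.≤-trans (ℕP.≤-reflexive (ℕP.+-identityʳ a′)) (ℕP.n≤1+n a′))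
                            (λ a′+0=a → ⊥-elim (n≢n+1 (trans (sym (ℕP.+-identityʳ a′)) a′+0=a)))

    one-carry : ∀ {D} → GreedyDown D → GreedyDown (a′ ℕ.+ 1 ∷ 0 ∷ D)
    one-carry g = greedyDown-∷ (ℕP.≤-reflexive (ℕP.+-comm a′ 1)) (λ _ → refl) (greedyDown-0∷ g)

    greedyDown-pred : ∀ {e L} → GreedyDown (ℕ.suc e ∷ L) → GreedyDown (e ∷ L)
    greedyDown-pred g with greedyDown-uncons g
    ... | 1+e≤a , _ , gL = greedyDown-∷ (ℕP.≤-trans (ℕP.n≤1+n _) 1+e≤a)
                              (λ e=a → ⊥-elim (ℕP.<-irrefl e=a 1+e≤a)) gL

  mutual
    lower-increment : ∀ {D} → GreedyDown D → Carry D
    lower-increment [] = carry 0 (no-carry [ ℕ.s≤s ℕ.z≤n ])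
      (solve 1 (λ s → con 0ℤ :+ s := s :* (con 1ℤ :+ con 0ℤ) :+ con 0ℤ) refl ϑ⁻¹)
    lower-increment {d ∷ []} [ d≤a ] with lower-increment₂ (d≤a ∷⟨ (λ _ → refl) ⟩ [ ℕ.z≤n ])
    ... | carry c g carried = carry c g (trans (cong (_+θ ϑ⁻¹) padding) carried)
      where
      padding : lowerValue (d ∷ []) ≡ lowerValue (d ∷ 0 ∷ [])
      padding = solve 2 (λ s x → s :* (x :+ con 0ℤ) := s :* (x :+ s :* (con 0ℤ :+ con 0ℤ))) refl ϑ⁻¹ ⌜ d ⌝
    lower-increment g@(_ ∷⟨ _ ⟩ _) = lower-increment₂ g

    lower-increment₂ : ∀ {d e r} → GreedyDown (d ∷ e ∷ r) → Carry (d ∷ e ∷ r)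
    lower-increment₂ {d} {e} {r} g with greedyDown-uncons g | ℕP.<-cmp d a′
    ... | _ , _ , ger | tri< d<a′ _ _ = carry 0
      (no-carry (greedyDown-∷ (ℕP.≤-trans d<a′ (ℕP.n≤1+n a′)) (λ 1+d=a → ⊥-elim (ℕP.<-irrefl (ℕP.suc-injective 1+d=a) d<a′)) ger))
      (raise-lower d (e ∷ r))
    lower-increment₂ {_} {ℕ.zero}   {r} g | _ , _ , ger | tri≈ _ refl _ =
      carry 0 (no-carry (greedyDown-∷ ℕP.≤-refl (λ _ → refl) ger)) (raise-lower a′ (0 ∷ r))
    lower-increment₂ {_} {ℕ.suc e′} {r} g | _ , _ , ger | tri≈ _ refl _ =
      carry 1 (one-carry (greedyDown-pred ger)) (lower-carry-rule e′ r)
    lower-increment₂ {d} {e} {r} g | d≤a , d=a⇒ , ger | tri> _ _ a′<d with ℕP.≤-antisym d≤a a′<d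
    ... | refl with d=a⇒ refl
    ...   | refl with lower-increment (proj₂ (proj₂ (greedyDown-uncons ger)))
    ...     | carry {r′} c′ g′ carried = carry 1 (one-carry g′) (lower-overflow-rule {r} {r′} {c′} carried)

  Increment : List ℕ → List ℕ → Set
  Increment L U = Σ Zipper λ z → value z ≡ lowerValue L +θ upperValue U +θ 𝟙

  descend : ∀ {x y} → (Σ Zipper λ z → value z ≡ x) → ϑ *θ x ≡ y → Σ Zipper λ z → value z ≡ y
  descend (z , eq) ϑx≡y = proj₁ (cursor-down z) , trans (proj₂ (cursor-down z)) (trans (cong (ϑ *θ_) eq) ϑx≡y)

  -- Adding 1 at the cursor; carries into the upper digits recurse on them, and the only
  -- carry into the lower digits is the overflow rule, handled by lower-increment.
  mutual
    increment-over-0 : ∀ {L U} → GreedyDown (0 ∷ L) → GreedyDigits a U → Increment (0 ∷ L) U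
    increment-over-0 {L} {[]}    gl _  = zipper gl [ ℕ.s≤s ℕ.z≤n ] (λ _ → refl) ,
      solve 2 (λ h t → h :+ (con 1ℤ :+ t :* con 0ℤ) := h :+ con 0ℤ :+ con 1ℤ) refl (lowerValue (0 ∷ L)) ϑ
    increment-over-0 {L} {d ∷ U} gl gu = increment-at gl gu (λ _ → refl)

    increment-at : ∀ {e L d U} → GreedyDown (e ∷ L) → GreedyDigits a (d ∷ U) → Junction (e ∷ L) (d ∷ U) →
                   Increment (e ∷ L) (d ∷ U)
    increment-at {e} {L} {d} {U} gl gu jn with ℕP.<-cmp d a′
    ... | tri< d<a′ _ _ =
      raise-digit gl gu (ℕP.≤-trans d<a′ (ℕP.n≤1+n a′)) (λ 1+d=a → ⊥-elim (ℕP.<-irrefl (ℕP.suc-injective 1+d=a) d<a′))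
    increment-at {ℕ.zero}   gl gu jn | tri≈ _ refl _ = raise-digit gl gu ℕP.≤-refl (λ _ → refl)
    increment-at {ℕ.suc e′} {L} {_} {U} gl gu jn | tri≈ _ refl _ =
      descend (increment-over-0 (greedyDown-0∷ (greedyDown-pred gl)) (proj₂ (proj₂ (greedyDigits-uncons gu))))
              (carry-rule e′ L U)
    increment-at {e} {L} {d} {U} gl gu jn | tri> _ _ a′<d with ℕP.≤-antisym (proj₁ (greedyDigits-uncons gu)) a′<d
    ... | refl with jn refl
    ...   | refl with lower-increment (proj₂ (proj₂ (greedyDown-uncons gl)))
    ...     | carry {L′} c′ g′ carried =
      descend (increment-over-0 (greedyDown-0∷ g′) (proj₂ (proj₂ (greedyDigits-uncons gu)))) (overflow-rule {L} {L′} {c′} carried U)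

    raise-digit : ∀ {L d U} → GreedyDown L → GreedyDigits a (d ∷ U) → ℕ.suc d ℕ.≤ a → (ℕ.suc d ≡ a → head₀ L ≡ 0) →
                  Increment L (d ∷ U)
    raise-digit {L} {d} {[]} gl gu 1+d≤a jn = zipper gl [ 1+d≤a ] jn , raise-upper L d []
    raise-digit {L} {d} {f ∷ U} gl gu 1+d≤a jn with f ℕP.≟ a
    ... | no f≢a = zipper gl (_∷_ 1+d≤a (λ f=a → ⊥-elim (f≢a f=a)) (proj₂ (proj₂ (greedyDigits-uncons gu)))) jn ,
                   raise-upper L d (f ∷ U)
    ... | yes refl with proj₁ (proj₂ (greedyDigits-uncons gu)) refl
    ...   | refl = descend (descend (increment-over-0 (greedyDown-0∷ (greedyDown-0∷ gl)) gU) refl) (double-carry-rule L U)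
      where
      gU = proj₂ (proj₂ (greedyDigits-uncons (proj₂ (proj₂ (greedyDigits-uncons gu)))))

  increment : (z : Zipper) → Σ Zipper λ z′ → value z′ ≡ value z +θ 𝟙
  increment (zipper {[]}    {U}     _  gu _)  =
    map₂ (λ eq → trans eq (cong (λ h → h +θ upperValue U +θ 𝟙) (*θ-zeroʳ ϑ⁻¹))) (increment-over-0 [ ℕ.z≤n ] gu)
  increment (zipper {e ∷ L} {[]}    gl _  _)  =
    map₂ (λ eq → trans eq (cong (λ u → lowerValue (e ∷ L) +θ u +θ 𝟙) (trans (+θ-identityˡ _) (*θ-zeroʳ ϑ))))
         (increment-at gl [ ℕ.z≤n ] (λ 0=a → ⊥-elim (0≢a 0=a)))
  increment (zipper {e ∷ L} {d ∷ U} gl gu jn) = increment-at gl gu jn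

  extend : ∀ {x t y} → (Σ Zipper λ z → value z ≡ x) → ((z : Zipper) → Σ Zipper λ z′ → value z′ ≡ value z +θ t) →
           x +θ t ≡ y → Σ Zipper λ z → value z ≡ y
  extend {t = t} (z , z≡x) add x+t≡y = proj₁ (add z) , trans (proj₂ (add z)) (trans (cong (_+θ t) z≡x) x+t≡y)

  add-ϑ : (z : Zipper) → Σ Zipper λ z′ → value z′ ≡ value z +θ ϑ
  add-ϑ z with cursor-up z
  ... | z₁ , ϑz₁≡z with increment z₁
  ...   | z₂ , z₂≡z₁+1 with cursor-down z₂
  ...     | z₃ , z₃≡ϑz₂ = z₃ , (begin
    value z₃                    ≡⟨ z₃≡ϑz₂ ⟩
    ϑ *θ value z₂               ≡⟨ cong (ϑ *θ_) z₂≡z₁+1 ⟩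
    ϑ *θ (value z₁ +θ 𝟙)        ≡⟨ solve 2 (λ t x → t :* (x :+ con 1ℤ) := t :* x :+ t) refl ϑ (value z₁) ⟩
    ϑ *θ value z₁ +θ ϑ          ≡⟨ cong (_+θ ϑ) ϑz₁≡z ⟩
    value z +θ ϑ                ∎)
    where open ≡-Reasoning

  natural-zipper : ∀ P Q → Σ Zipper λ z → value z ≡ (+ P , + Q)
  natural-zipper ℕ.zero    ℕ.zero    = zipper [] [] (λ 0=a → ⊥-elim (0≢a 0=a)) , refl
  natural-zipper (ℕ.suc P) ℕ.zero    =
    extend (natural-zipper P 0) increment (cong₂ _,_ (cong +_ (ℕP.+-comm P 1)) refl)
  natural-zipper P         (ℕ.suc Q) =
    extend (natural-zipper P Q) add-ϑ (cong₂ _,_ (ℤP.+-identityʳ (+ P)) (cong +_ (ℕP.+-comm Q 1)))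

  evalDigits≡ϑ^*upperValue : ∀ m U → evalDigits a m U ≡ ϑ^ m *θ upperValue U
  evalDigits≡ϑ^*upperValue m []      = sym (*θ-zeroʳ (ϑ^ m))
  evalDigits≡ϑ^*upperValue m (b ∷ U) = begin
    ⌜ b ⌝ *θ ϑ^ m +θ evalDigits a (m + 1ℤ) U        ≡⟨ cong (⌜ b ⌝ *θ ϑ^ m +θ_) (evalDigits≡ϑ^*upperValue (m + 1ℤ) U) ⟩
    ⌜ b ⌝ *θ ϑ^ m +θ ϑ^ (m + 1ℤ) *θ upperValue U    ≡⟨ cong (λ p → ⌜ b ⌝ *θ ϑ^ m +θ p *θ upperValue U) (ϑ^-suc m) ⟩
    ⌜ b ⌝ *θ ϑ^ m +θ ϑ^ m *θ ϑ *θ upperValue U      ≡⟨ solve 4 (λ x p t u → x :* p :+ p :* t :* u := p :* (x :+ t :* u)) refl ⌜ b ⌝ (ϑ^ m) ϑ (upperValue U) ⟩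
    ϑ^ m *θ (⌜ b ⌝ +θ ϑ *θ upperValue U)            ∎
    where open ≡-Reasoning

  zipper⇒expansion : ∀ j z → HasGreedyExpansion (ϑ^ j *θ value z)
  zipper⇒expansion j (zipper gl gu jn) = go j gl gu jn
    where
    go : ∀ j {L U} → GreedyDown L → GreedyDigits a U → Junction L U →
         HasGreedyExpansion (ϑ^ j *θ (lowerValue L +θ upperValue U))
    go j {[]}    {U} _  gu _  =
      j , U , gu , trans (evalDigits≡ϑ^*upperValue j U) (cong (ϑ^ j *θ_) (sym (+θ-identityˡ (upperValue U))))
    go j {e ∷ L} {U} gl gu jn with greedyDown-uncons gl
    ... | e≤a , e=a⇒ , gL = subst HasGreedyExpansion shifted (go (j - 1ℤ) gL (greedyDigits-∷ e≤a jn gu) e=a⇒)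
      where
      shifted : ϑ^ (j - 1ℤ) *θ (lowerValue L +θ upperValue (e ∷ U)) ≡ ϑ^ j *θ (lowerValue (e ∷ L) +θ upperValue U)
      shifted = begin
        ϑ^ (j - 1ℤ) *θ (lowerValue L +θ upperValue (e ∷ U))        ≡⟨ cong (ϑ^ (j - 1ℤ) *θ_) (shift-value e L U) ⟩
        ϑ^ (j - 1ℤ) *θ (ϑ *θ (lowerValue (e ∷ L) +θ upperValue U)) ≡⟨ sym (*θ-assoc (ϑ^ (j - 1ℤ)) ϑ _) ⟩
        ϑ^ (j - 1ℤ) *θ ϑ *θ (lowerValue (e ∷ L) +θ upperValue U)   ≡⟨ cong (_*θ (lowerValue (e ∷ L) +θ upperValue U)) (ϑ^-pred*ϑ j) ⟩
        ϑ^ j *θ (lowerValue (e ∷ L) +θ upperValue U)               ∎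
        where open ≡-Reasoning

  nonneg⇒expansion : ∀ {x} → Nonneg x → HasGreedyExpansion x
  nonneg⇒expansion {x} (nonneg {n} P Q eq) = subst HasGreedyExpansion value≡x (zipper⇒expansion (- + n) z)
    where
    open ≡-Reasoning
    z = proj₁ (natural-zipper P Q)
    value≡x : ϑ^ (- + n) *θ value z ≡ x
    value≡x = begin
      ϑ^ (- + n) *θ value z     ≡⟨ cong₂ _*θ_ (ϑ^-neg n) (trans (proj₂ (natural-zipper P Q)) (sym eq)) ⟩
      ϑ⁻ⁿ n *θ (x *θ ϑⁿ n)      ≡⟨ solve 3 (λ s x t → s :* (x :* t) := x :* (s :* t)) refl (ϑ⁻ⁿ n) x (ϑⁿ n) ⟩
      x *θ (ϑ⁻ⁿ n *θ ϑⁿ n)      ≡⟨ cong (x *θ_) (ϑ⁻ⁿ*ϑⁿ n) ⟩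
      x *θ 𝟙                    ≡⟨ *θ-identityʳ x ⟩
      x                         ∎

  open Positivity a using (positive-*θ; positive-q<0; positive-nonpositive)
  open IntegerFacts

  *ϑ-coordinates : ∀ p q → (p , q) *θ ϑ ≡ (q , p + A * q)
  *ϑ-coordinates p q = cong₂ _,_ (first p q) (second A p q)
    where
    first : ∀ p q → p * 0ℤ + q * 1ℤ ≡ q
    first = solve-∀
    second : ∀ A p q → p * 1ℤ + q * 0ℤ + A * (q * 1ℤ) ≡ p + A * q
    second = solve-∀

  nonneg-*ϑ⁻¹ : ∀ {x} → Nonneg (x *θ ϑ) → Nonneg x
  nonneg-*ϑ⁻¹ {x} (nonneg {n} P Q eq) = nonneg {exponent = ℕ.suc n} P Q (trans (sym (*θ-assoc x ϑ (ϑⁿ n))) eq)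

  -- Multiplying by θ, (p , q) ↦ (q , p + a q), strictly decreases |p| + |q| until both
  -- coordinates are nonnegative; positivity rules out the remaining sign patterns.
  positive⇒nonneg : ∀ {x} → Positive a x → Nonneg x
  positive⇒nonneg {p , q} x>0 = go (ℕ.suc (size p q)) p q x>0 ℕP.≤-refl
    where
    size : ℤ → ℤ → ℕ
    size p q = ℤ.∣ p ∣ ℕ.+ ℤ.∣ q ∣

    step : ∀ {p q} → Nonneg (q , p + A * q) → Nonneg (p , q)
    step {p} {q} = nonneg-*ϑ⁻¹ ∘ subst Nonneg (sym (*ϑ-coordinates p q))

    ∣neg∣ : ∀ {x} → x ℤ.< 0ℤ → + ℤ.∣ x ∣ ≡ - x
    ∣neg∣ { -[1+ _ ]} _         = refl
    ∣neg∣ {+ _}       (ℤ.+<+ ())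

    go : ∀ fuel p q → Positive a (p , q) → size p q ℕ.< fuel → Nonneg (p , q)
    go (ℕ.suc fuel) (+ P)    (+ Q)    _   _ = nonneg {exponent = 0} P Q (*θ-identityʳ _)
    go (ℕ.suc fuel) -[1+ P ] -[1+ Q ] x>0 _ = ⊥-elim (positive-nonpositive { -[1+ P ]} { -[1+ Q ]} x>0 ℤ.-≤+ ℤ.-≤+)
    go (ℕ.suc fuel) (+ P)    -[1+ Q ] x>0 (ℕ.s≤s size≤) = step (go fuel -[1+ Q ] r (positive-*θ {+ P} { -[1+ Q ]} x>0) smaller)
      where
      r = + P + A * -[1+ Q ]
      0<r = positive-q<0 {+ P} { -[1+ Q ]} x>0 ℤ.-<+
      r<P : r ℤ.< + P
      r<P = subst (r ℤ.<_) (ℤP.+-identityʳ (+ P)) (ℤP.+-monoʳ-< (+ P) ℤ.-<+)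
      smaller : ℕ.suc Q ℕ.+ ℤ.∣ r ∣ ℕ.< fuel
      smaller = ℕP.<-≤-trans (ℕP.+-monoʳ-< (ℕ.suc Q) (ℤP.drop‿+<+ (subst (ℤ._< + P) (sym (ℤP.0≤i⇒+∣i∣≡i (ℤP.<⇒≤ 0<r))) r<P)))
                            (ℕP.≤-trans (ℕP.≤-reflexive (ℕP.+-comm (ℕ.suc Q) P)) size≤)
    go (ℕ.suc fuel) -[1+ P ] (+ Q)    x>0 (ℕ.s≤s size≤) with 0ℤ ℤP.≤? -[1+ P ] + A * + Q
    ... | yes 0≤r = step (nonneg {exponent = 0} Q ℤ.∣ r ∣ (trans (*θ-identityʳ _) (cong (+ Q ,_) (sym (ℤP.0≤i⇒+∣i∣≡i 0≤r)))))
      where r = -[1+ P ] + A * + Q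
    ... | no  0≰r with Q
    ...   | ℕ.zero   = ⊥-elim (positive-nonpositive { -[1+ P ]} {+ 0} x>0 ℤ.-≤+ ℤP.≤-refl)
    ...   | ℕ.suc Q′ = step (go fuel (+ ℕ.suc Q′) r (positive-*θ { -[1+ P ]} {+ ℕ.suc Q′} x>0) smaller)
      where
      r = -[1+ P ] + A * + ℕ.suc Q′
      r<0 = ℤP.≰⇒> 0≰r
      P<r : -[1+ P ] ℤ.< r
      P<r = subst (ℤ._< r) (ℤP.+-identityʳ -[1+ P ]) (ℤP.+-monoʳ-< -[1+ P ] (0<-* (0<+suc a′) (0<+suc Q′)))
      smaller : ℕ.suc Q′ ℕ.+ ℤ.∣ r ∣ ℕ.< fuel
      smaller = ℕP.<-≤-trans (ℕP.+-monoʳ-< (ℕ.suc Q′) (ℤP.drop‿+<+ (subst (ℤ._< + ℕ.suc P) (sym (∣neg∣ r<0)) (ℤP.neg-mono-< P<r))))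
                            (ℕP.≤-trans (ℕP.≤-reflexive (ℕP.+-comm (ℕ.suc Q′) (ℕ.suc P))) size≤)

module Convergence (a′ : ℕ) where

  open Existence a′
  open ZTheta a
  open IntegerFacts
  open Solver using (solve; _:+_; _:*_; _:-_; :-_; _:=_; con)

  ϑ^-≤-suc : ∀ j → Nonneg (ϑ^ (j + 1ℤ) -θ ϑ^ j)
  ϑ^-≤-suc j = subst Nonneg (sym split) (nonneg-+ (nonneg-digit a′ j) (pos⇒nonneg (pos-ϑ^ (j - 1ℤ))))
    where
    open ≡-Reasoning
    split : ϑ^ (j + 1ℤ) -θ ϑ^ j ≡ ⌜ a′ ⌝ *θ ϑ^ j +θ ϑ^ (j - 1ℤ)
    split = begin
      ϑ^ (j + 1ℤ) -θ ϑ^ j                          ≡⟨ cong (_-θ ϑ^ j) (ϑ^-rec j) ⟩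
      ⌜ a ⌝ *θ ϑ^ j +θ ϑ^ (j - 1ℤ) -θ ϑ^ j         ≡⟨ cong (λ x → x *θ ϑ^ j +θ ϑ^ (j - 1ℤ) -θ ϑ^ j) (⌜suc⌝ a′) ⟩
      (𝟙 +θ ⌜ a′ ⌝) *θ ϑ^ j +θ ϑ^ (j - 1ℤ) -θ ϑ^ j ≡⟨ solve 3 (λ c p q → (con 1ℤ :+ c) :* p :+ q :- p := c :* p :+ q) refl ⌜ a′ ⌝ (ϑ^ j) (ϑ^ (j - 1ℤ)) ⟩
      ⌜ a′ ⌝ *θ ϑ^ j +θ ϑ^ (j - 1ℤ)               ∎

  ϑ^-mono : ∀ {k j} → k ℤ.≤ j → Nonneg (ϑ^ j -θ ϑ^ k)
  ϑ^-mono {k} k≤j = subst (λ j → Nonneg (ϑ^ j -θ ϑ^ k)) (sym (i≤j⇒j≡i+∣i-j∣ k≤j)) (from-k ℤ.∣ k - _ ∣)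
    where
    from-k : ∀ d → Nonneg (ϑ^ (k + + d) -θ ϑ^ k)
    from-k ℕ.zero    = subst Nonneg (sym (trans (cong (λ i → ϑ^ i -θ ϑ^ k) (ℤP.+-identityʳ k)) (negθ-inverseʳ (ϑ^ k)))) nonneg-𝟘
    from-k (ℕ.suc d) = subst Nonneg (sym split) (nonneg-+ (ϑ^-≤-suc (k + + d)) (from-k d))
      where
      split : ϑ^ (k + + ℕ.suc d) -θ ϑ^ k ≡ ϑ^ (k + + d + 1ℤ) -θ ϑ^ (k + + d) +θ (ϑ^ (k + + d) -θ ϑ^ k)
      split = trans (cong (λ i → ϑ^ i -θ ϑ^ k) (i+[1+n]≡i+n+1 k d))
                    (solve 3 (λ x y z → x :- z := x :- y :+ (y :- z)) refl (ϑ^ (k + + d + 1ℤ)) (ϑ^ (k + + d)) (ϑ^ k))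

  evalDigits-zero-or-≥ : ∀ m es {k} → k ℤ.≤ m → evalDigits a m es ≡ 𝟘 ⊎ Nonneg (evalDigits a m es -θ ϑ^ k)
  evalDigits-zero-or-≥ m []            _   = inj₁ refl
  evalDigits-zero-or-≥ m (ℕ.zero ∷ es) {k} k≤m =
    Data.Sum.map (λ rest≡𝟘 → trans (cong (_+θ E) (*θ-zeroˡ (ϑ^ m))) (trans (+θ-identityˡ E) rest≡𝟘))
                 (subst Nonneg (sym (cong (_-θ ϑ^ k) (trans (cong (_+θ E) (*θ-zeroˡ (ϑ^ m))) (+θ-identityˡ E)))))
                 (evalDigits-zero-or-≥ (m + 1ℤ) es (ℤP.≤-trans k≤m (ℤP.<⇒≤ (i<i+1 m))))
    where
    E = evalDigits a (m + 1ℤ) es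
  evalDigits-zero-or-≥ m (ℕ.suc b ∷ es) {k} k≤m = inj₂ (subst Nonneg (sym split)
    (nonneg-+ (nonneg-digit b m) (nonneg-+ (ϑ^-mono k≤m) (evalDigits-nonneg (m + 1ℤ) es))))
    where
    E = evalDigits a (m + 1ℤ) es
    split : ⌜ ℕ.suc b ⌝ *θ ϑ^ m +θ E -θ ϑ^ k ≡ ⌜ b ⌝ *θ ϑ^ m +θ (ϑ^ m -θ ϑ^ k +θ E)
    split = trans (cong (λ x → x *θ ϑ^ m +θ E -θ ϑ^ k) (⌜suc⌝ b))
                  (solve 4 (λ x p q e → (con 1ℤ :+ x) :* p :+ e :- q := x :* p :+ (p :- q :+ e)) refl ⌜ b ⌝ (ϑ^ m) (ϑ^ k) E)

  s≡α+ : ∀ {s α r} → s -θ α ≡ r → s ≡ α +θ r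
  s≡α+ {s} {α} eq = trans (solve 2 (λ s x → s := x :+ (s :- x)) refl s α) (cong (α +θ_) eq)

  -- If s ≥ 0, α < θ^t ≤ θ^k and s - α is ± a greedy polynomial starting at or above k,
  -- the sign must be +: otherwise α = s + (that polynomial) ≥ θ^k.
  smallBy⇒α+greedy : ∀ {α s t k} → Pos (ϑ^ t -θ α) → t ℤ.≤ k → Nonneg s → SmallBy a k (s -θ α) →
                     ∃[ m ] ∃[ es ] k ℤ.≤ m × GreedyDigits a es × s ≡ α +θ evalDigits a m es
  smallBy⇒α+greedy {α} {s} {k = k} _ _ _ (inj₁ s-α≡𝟘) = k , [] , ℤP.≤-refl , [] , s≡α+ s-α≡𝟘
  smallBy⇒α+greedy _ _ _ (inj₂ (m , es , k≤m , ges , inj₁ s-α≡E)) = m , es , k≤m , ges , s≡α+ s-α≡E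
  smallBy⇒α+greedy {α} {s} {t} {k} α<ϑ^t t≤k s≥0 (inj₂ (m , es , k≤m , ges , inj₂ s-α≡-E)) =
    Data.Sum.[ (λ E≡𝟘 → m , es , k≤m , ges , s≡α+ (trans s-α≡-E (trans (cong negθ E≡𝟘) (sym E≡𝟘))))
             , (λ E≥ϑ^k → ⊥-elim (pos⇒≢𝟘 (pos-+ ϑ^k>α (α≥ϑ^k E≥ϑ^k)) cancel)) ]′
      (evalDigits-zero-or-≥ m es k≤m)
    where
    E = evalDigits a m es
    ϑ^k>α : Pos (ϑ^ k -θ α)
    ϑ^k>α = subst Pos (solve 3 (λ k t x → k :- t :+ (t :- x) := k :- x) refl (ϑ^ k) (ϑ^ t) α)
                  (nonneg-+-pos (ϑ^-mono t≤k) α<ϑ^t)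
    α≥ϑ^k : Nonneg (E -θ ϑ^ k) → Nonneg (α -θ ϑ^ k)
    α≥ϑ^k E≥ϑ^k = subst Nonneg (sym α-ϑ^k) (nonneg-+ s≥0 E≥ϑ^k)
      where
      α-ϑ^k : α -θ ϑ^ k ≡ s +θ (E -θ ϑ^ k)
      α-ϑ^k = begin
        α -θ ϑ^ k                   ≡⟨ cong (_-θ ϑ^ k) (solve 2 (λ x s → x := s :- (s :- x)) refl α s) ⟩
        s -θ (s -θ α) -θ ϑ^ k       ≡⟨ cong (λ y → s -θ y -θ ϑ^ k) s-α≡-E ⟩
        s -θ negθ E -θ ϑ^ k         ≡⟨ solve 3 (λ s e k → s :- (:- e) :- k := s :+ (e :- k)) refl s E (ϑ^ k) ⟩
        s +θ (E -θ ϑ^ k)            ∎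
        where open ≡-Reasoning
    cancel : ϑ^ k -θ α +θ (α -θ ϑ^ k) ≡ 𝟘
    cancel = solve 2 (λ k x → k :- x :+ (x :- k) := con 0ℤ) refl (ϑ^ k) α

  πEq⇒same-digits : ∀ {α m bs} → GreedyDigits a bs → evalDigits a m bs ≡ α → (x : GreedySeries a) → πEq a x α →
                    ∀ i → digit x i ≡ digitAt m bs i
  πEq⇒same-digits {α} {m} {bs} gbs value≡α x π i = from-small (π k)
    where
    t = m + + length bs
    k = t ℤ.⊔ i + 1ℤ
    t<k = ℤP.≤-<-trans (ℤP.i≤i⊔j t i) (i<i+1 (t ℤ.⊔ i))
    i<k = ℤP.≤-<-trans (ℤP.i≤j⊔i t i) (i<i+1 (t ℤ.⊔ i))

    α<ϑ^t : Pos (ϑ^ t -θ α)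
    α<ϑ^t = subst (λ y → Pos (ϑ^ t -θ y)) (trans (sym (evalDigits≡digitSum m bs)) value≡α)
                  (digitSum<ϑ^ (digitAt-greedy m gbs) m (length bs))

    from-small : ∃[ N ] (∀ n → N ℕ.≤ n → SmallBy a k (partial a x n -θ α)) → digit x i ≡ digitAt m bs i
    from-small (N , small) = from-sum (smallBy⇒α+greedy α<ϑ^t (ℤP.<⇒≤ t<k) (digitSum-nonneg (digit x) (low x) n) (small n (ℕP.m≤m+n N _)))
      where
      n = N ℕ.+ ℤ.∣ low x - k ∣
      k≤top : k ℤ.≤ low x + + n
      k≤top = ℤP.≤-trans (j≤i+∣i-j∣ (low x) k) (ℤP.+-monoʳ-≤ (low x) (ℤ.+≤+ (ℕP.m≤n+m _ N)))
      xs = digitsFrom (digit x) (low x) n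
      from-sum : ∃[ m₂ ] ∃[ es ] k ℤ.≤ m₂ × GreedyDigits a es × partial a x n ≡ α +θ evalDigits a m₂ es →
                 digit x i ≡ digitAt m bs i
      from-sum (m₂ , es , k≤m₂ , ges , sum) = begin
        digit x i              ≡⟨ digit≡digitAt-digitsFrom x n i (ℤP.<-≤-trans i<k k≤top) ⟩
        digitAt (low x) xs i   ≡⟨ greedy-unique-below (digitsFrom-greedy (series-greedy x) (low x) n) gbs ges
                                    (ℤP.<-≤-trans t<k k≤m₂) xs-value i (ℤP.<-≤-trans i<k k≤m₂) ⟩
        digitAt m bs i         ∎
        where
        open ≡-Reasoning
        xs-value : evalDigits a (low x) xs ≡ evalDigits a m bs +θ evalDigits a m₂ es
        xs-value = trans (sym (digitSum≡evalDigits (digit x) (low x) n)) (trans sum (cong (_+θ evalDigits a m₂ es) (sym value≡α)))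

theorem23 : (a : ℕ) → 1 ≤ a → (α : ℤθ) → Positive a α →
    (x : GreedySeries a) → πEq a x α ⇔ IsGreedyExpansionOf a x α
theorem23 (ℕ.suc a′) _ α α>0 x = mk⇔ (forward (nonneg⇒expansion (positive⇒nonneg α>0))) (expansion⇒πEq x α)
  where
  open Existence a′ using (HasGreedyExpansion; nonneg⇒expansion; positive⇒nonneg)
  open Convergence a′ using (πEq⇒same-digits)
  open ZTheta (ℕ.suc a′) using (expansion⇒πEq; same-digits⇒expansion)
  forward : HasGreedyExpansion α → πEq (ℕ.suc a′) x α → IsGreedyExpansionOf (ℕ.suc a′) x α
  forward (m , bs , gbs , value≡α) π = same-digits⇒expansion value≡α x (πEq⇒same-digits gbs value≡α x π)
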